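{- Let $x$ be an indeterminate and $m,n$ positive integers with $m\ge n$. For $1\le k\le m$ put $a_k=\binom{m+k}{k}\binom{m}{k}\binom{n+k}{k}\binom{n}{k}$, $h_k=H^{(1)}_{m+k}+H^{(1)}_{m-k}+H^{(1)}_{n+k}+H^{(1)}_{n-k}-4H^{(1)}_k$ (for $k\le n$) and $b_k=\binom{m+k}{k}\binom{m}{k}\binom{n+k}{k}\big/\binom{k-1}{n}$ (for $n<k\le m$). Then, as rational functions of $x$, \[ \frac{x\,(1-x)_n(1-x)_m}{(x)_{n+1}(x)_{m+1}} = \frac1x + \sum_{k=1}^{n} a_k\left\{\frac{ -k}{(x+k)^2}+\frac{1+k\,h_k}{x+k}\right\} + \sum_{k=n+1}^{m}\frac{(-1)^{k-n}\,b_k}{x+k}. \]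
   Context: $(a)_0=1$, $(a)_n=a(a+1)\cdots(a+n-1)$. Generalised harmonic sums: $H^{(i)}_n=\sum_{j=1}^n j^{ -i}$ for $n\ge1$ and $H^{(i)}_0=0$. -}

module Defs where

open import Data.Nat as ℕ using (ℕ; zero; suc; _∸_)
open import Data.Nat.Combinatorics using (_C_)
open import Data.Integer using (+_)
open import Data.Rational using (ℚ; 0ℚ; 1ℚ; _+_; _*_; _-_; -_; 1/_; ≢-nonZero)
open import Data.Rational.Properties using (_≟_)
open import Relation.Nullary using (yes; no)

ι : ℕ → ℚ
ι n = Data.Rational._/_ (+ n) 1

-- total reciprocal (inv 0 = 0); only ever applied to nonzero values below
inv : ℚ → ℚ
inv q with q ≟ 0ℚ
... | yes _ = 0ℚ
... | no q≢0 = 1/_ q {{≢-nonZero q≢0}}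

_÷'_ : ℚ → ℚ → ℚ
p ÷' q = p * inv q

poch : ℚ → ℕ → ℚ
poch a zero = 1ℚ
poch a (suc n) = poch a n * (a + ι n)

sumBelow : ℕ → (ℕ → ℚ) → ℚ
sumBelow zero f = 0ℚ
sumBelow (suc n) f = sumBelow n f + f n

-- Σ_{k=a}^{b} f k  (empty if b < a)
sumFromTo : ℕ → ℕ → (ℕ → ℚ) → ℚ
sumFromTo a b f = sumBelow (suc b ∸ a) (λ i → f (a ℕ.+ i))

H : ℕ → ℚ
H n = sumFromTo 1 n (λ j → inv (ι j))

sgn : ℕ → ℚ
sgn zero = 1ℚ
sgn (suc n) = - sgn n

aCoef : ℕ → ℕ → ℕ → ℚ
aCoef m n k = ι (((m ℕ.+ k) C k) ℕ.* (m C k) ℕ.* ((n ℕ.+ k) C k) ℕ.* (n C k))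

-- h_k = H_{m+k} + H_{m-k} + H_{n+k} + H_{n-k} - 4 H_k   (used for k ≤ n ≤ m)
hCoef : ℕ → ℕ → ℕ → ℚ
hCoef m n k = H (m ℕ.+ k) + H (m ∸ k) + H (n ℕ.+ k) + H (n ∸ k) - ι 4 * H k

-- b_k = C(m+k,k) C(m,k) C(n+k,k) / C(k-1,n)   (used for n < k ≤ m)
bCoef : ℕ → ℕ → ℕ → ℚ
bCoef m n k = ι (((m ℕ.+ k) C k) ℕ.* (m C k) ℕ.* ((n ℕ.+ k) C k)) ÷' ι ((k ∸ 1) C n)

lhs : ℕ → ℕ → ℚ → ℚ
lhs m n x = (x * poch (1ℚ - x) n * poch (1ℚ - x) m) ÷' (poch x (suc n) * poch x (suc m))

rhs : ℕ → ℕ → ℚ → ℚ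
rhs m n x =
  inv x
  + sumFromTo 1 n (λ k → aCoef m n k *
        ((- ι k) ÷' ((x + ι k) * (x + ι k)) + (1ℚ + ι k * hCoef m n k) ÷' (x + ι k)))
  + sumFromTo (suc n) m (λ k → (sgn (k ∸ n) * bCoef m n k) ÷' (x + ι k))

{-# OPTIONS --safe #-}
module Submission where

-- Write P_m(x) = (1-x)_m / (x)_{m+1} as Σ_{j≤m} r_{m,j} / (x+j) with r_{m,j} = (-1)^j C(m+j,j) C(m,j),
-- by induction on m from P_{m+1} = P_m · (m+1-x)/(x+m+1).  The left side is x P_n(x) P_m(x); multiplying
-- out the two expansions and splitting each x/((x+k)(x+j)) into partial fractions leaves, at the pole -k,
-- the regular parts R_m(k) = Σ_{j≠k} r_{m,j}/(k-j).  For k ≤ m, R_m(k) = r_{m,k} (H_{m+k} + H_{m-k} - 2 H_k),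
-- again by induction on m, the new diagonal case coming from the identity P′ = P (log P)′ at x = -(m+1);
-- this yields the double poles and h_k.  For n < k ≤ m, R_n(k) = -P_n(-k), whose closed form gives b_k.

open import Defs
open import Data.Nat using (ℕ; _≤_; _≥_; NonZero)
open import Data.Rational using (ℚ; 0ℚ; _+_)
open import Relation.Binary.PropositionalEquality using (_≡_; _≢_)
open import Data.Nat as ℕ using (zero; suc; _∸_; _<_; z≤n; s≤s)
import Data.Nat.Properties as ℕP
import Data.Nat.Tactic.RingSolver as ℕSolver
open import Data.Nat.Combinatorics using (_C_; nCk+nC[k+1]≡[n+1]C[k+1]; nC1≡n; nCn≡1)
open import Data.Nat.Coprimality using (1-coprimeTo)
import Data.Nat.Coprimality as Coprimality
import Data.Integer as ℤ
import Data.Integer.Properties as ℤP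
open import Data.Rational using (1ℚ; _*_; _-_; -_; ≢-nonZero; toℚᵘ)
import Data.Rational.Properties as QP
import Data.Rational.Unnormalised as ℚᵘ
import Data.Rational.Unnormalised.Properties as ℚᵘP
open import Data.Empty using (⊥-elim)
open import Data.Maybe.Base using (Maybe; just; nothing)
open import Data.Sum using (inj₁; inj₂)
open import Level using (0ℓ)
open import Relation.Binary.PropositionalEquality using (refl; sym; trans; cong; cong₂; module ≡-Reasoning)
open import Relation.Nullary using (yes; no; Dec)
open import Tactic.RingSolver using (solve-∀)
import Tactic.RingSolver.Core.AlmostCommutativeRing as ACR

ℚ-ring : ACR.AlmostCommutativeRing 0ℓ 0ℓ
ℚ-ring = ACR.fromCommutativeRing QP.+-*-commutativeRing 0≟
  where
  0≟ : ∀ x → Maybe (0ℚ ≡ x)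
  0≟ x with 0ℚ QP.≟ x
  ... | yes p = just p
  ... | no _  = nothing

p-q≡0⇒p≡q : ∀ p q → p - q ≡ 0ℚ → p ≡ q
p-q≡0⇒p≡q p q p-q≡0 = begin
  p             ≡⟨ split p q ⟩
  (p - q) + q   ≡⟨ cong (_+ q) p-q≡0 ⟩
  0ℚ + q        ≡⟨ QP.+-identityˡ q ⟩
  q             ∎
  where
  open ≡-Reasoning
  split : ∀ p q → p ≡ (p - q) + q
  split = solve-∀ ℚ-ring

inv-inverseʳ : ∀ q → q ≢ 0ℚ → q * inv q ≡ 1ℚ
inv-inverseʳ q q≢0 with q QP.≟ 0ℚ
... | yes q≡0 = ⊥-elim (q≢0 q≡0)
... | no q≢0′ = QP.*-inverseʳ q {{≢-nonZero q≢0′}}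

inv-cancelˡ : ∀ a b → a ≢ 0ℚ → inv a * (a * b) ≡ b
inv-cancelˡ a b a≢0 = begin
  inv a * (a * b)  ≡⟨ reassoc a b (inv a) ⟩
  (a * inv a) * b  ≡⟨ cong (_* b) (inv-inverseʳ a a≢0) ⟩
  1ℚ * b           ≡⟨ QP.*-identityˡ b ⟩
  b                ∎
  where
  open ≡-Reasoning
  reassoc : ∀ a b i → i * (a * b) ≡ (a * i) * b
  reassoc = solve-∀ ℚ-ring

*-cancelʳ-≢0 : ∀ p q c → c ≢ 0ℚ → p * c ≡ q * c → p ≡ q
*-cancelʳ-≢0 p q c c≢0 pc≡qc = begin
  p                ≡⟨ sym (inv-cancelˡ c p c≢0) ⟩
  inv c * (c * p)  ≡⟨ cong (inv c *_) (trans (QP.*-comm c p) (trans pc≡qc (QP.*-comm q c))) ⟩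
  inv c * (c * q)  ≡⟨ inv-cancelˡ c q c≢0 ⟩
  q                ∎
  where open ≡-Reasoning

*-≢0 : ∀ p q → p ≢ 0ℚ → q ≢ 0ℚ → p * q ≢ 0ℚ
*-≢0 p q p≢0 q≢0 pq≡0 = q≢0 (begin
  q                ≡⟨ sym (inv-cancelˡ p q p≢0) ⟩
  inv p * (p * q)  ≡⟨ cong (inv p *_) pq≡0 ⟩
  inv p * 0ℚ       ≡⟨ QP.*-zeroʳ (inv p) ⟩
  0ℚ               ∎)
  where open ≡-Reasoning

inv-unique : ∀ a b → a ≢ 0ℚ → b * a ≡ 1ℚ → inv a ≡ b
inv-unique a b a≢0 ba≡1 =
  *-cancelʳ-≢0 (inv a) b a a≢0 (trans (QP.*-comm (inv a) a) (trans (inv-inverseʳ a a≢0) (sym ba≡1)))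

inv-* : ∀ p q → inv (p * q) ≡ inv p * inv q
inv-* p q = by-cases (p QP.≟ 0ℚ) (q QP.≟ 0ℚ)
  where
  open ≡-Reasoning
  regroup : ∀ p q i j → i * j * (p * q) ≡ (p * i) * (q * j)
  regroup = solve-∀ ℚ-ring
  by-cases : Dec (p ≡ 0ℚ) → Dec (q ≡ 0ℚ) → inv (p * q) ≡ inv p * inv q
  by-cases (yes refl) _ = trans (cong inv (QP.*-zeroˡ q)) (sym (QP.*-zeroˡ (inv q)))
  by-cases (no _) (yes refl) = trans (cong inv (QP.*-zeroʳ p)) (sym (QP.*-zeroʳ (inv p)))
  by-cases (no p≢0) (no q≢0) = inv-unique (p * q) (inv p * inv q) (*-≢0 p q p≢0 q≢0) (begin
    inv p * inv q * (p * q)    ≡⟨ regroup p q (inv p) (inv q) ⟩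
    (p * inv p) * (q * inv q)  ≡⟨ cong₂ _*_ (inv-inverseʳ p p≢0) (inv-inverseʳ q q≢0) ⟩
    1ℚ                         ∎)

inv-neg : ∀ p → inv (- p) ≡ - inv p
inv-neg p = by-cases (p QP.≟ 0ℚ)
  where
  negs : ∀ p i → (- i) * (- p) ≡ p * i
  negs = solve-∀ ℚ-ring
  by-cases : Dec (p ≡ 0ℚ) → inv (- p) ≡ - inv p
  by-cases (yes refl) = refl
  by-cases (no p≢0) = inv-unique (- p) (- inv p) (λ -p≡0 → p≢0 (QP.neg-injective -p≡0))
                        (trans (negs p (inv p)) (inv-inverseʳ p p≢0))

inv-[a-b]≡-inv-[-a+b] : ∀ a b → inv (a - b) ≡ - inv (- a + b)
inv-[a-b]≡-inv-[-a+b] a b = trans (cong inv (negate a b)) (inv-neg (- a + b))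
  where
  negate : ∀ a b → a - b ≡ - (- a + b)
  negate = solve-∀ ℚ-ring

inv-[-a+b]≡-inv-[a-b] : ∀ a b → inv (- a + b) ≡ - inv (a - b)
inv-[-a+b]≡-inv-[a-b] a b = trans (cong inv (negate a b)) (inv-neg (a - b))
  where
  negate : ∀ a b → - a + b ≡ - (a - b)
  negate = solve-∀ ℚ-ring

inv-swap : ∀ a b → inv (a - b) ≡ - inv (b - a)
inv-swap a b = trans (inv-[a-b]≡-inv-[-a+b] a b) (cong (λ z → - inv z) (QP.+-comm (- a) b))

-- An identity between expressions in formal inverses a⁻¹ holds in ℚ as soon as the difference of
-- its sides lies in the ideal generated by the 1 - a * a⁻¹; the ring solver checks that membership.
≡-modulo-inverses : ∀ u v c₁ c₂ c₃ e₁ e₂ e₃ →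
  u - v ≡ c₁ * (1ℚ - e₁) + c₂ * (1ℚ - e₂) + c₃ * (1ℚ - e₃) →
  e₁ ≡ 1ℚ → e₂ ≡ 1ℚ → e₃ ≡ 1ℚ → u ≡ v
≡-modulo-inverses u v c₁ c₂ c₃ _ _ _ u-v≡ refl refl refl = p-q≡0⇒p≡q u v (trans u-v≡ (vanish c₁ c₂ c₃))
  where
  vanish : ∀ c₁ c₂ c₃ → c₁ * (1ℚ - 1ℚ) + c₂ * (1ℚ - 1ℚ) + c₃ * (1ℚ - 1ℚ) ≡ 0ℚ
  vanish = solve-∀ ℚ-ring

ι-toℚᵘ : ∀ n → toℚᵘ (ι n) ≡ ℚᵘ.mkℚᵘ (ℤ.+ n) 0
ι-toℚᵘ n = cong toℚᵘ (QP.normalize-coprime {n} {0} (Coprimality.sym (1-coprimeTo n)))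

ι-+ : ∀ a b → ι (a ℕ.+ b) ≡ ι a + ι b
ι-+ a b = QP.toℚᵘ-injective (ℚᵘP.≃-trans (ℚᵘP.≃-reflexive (ι-toℚᵘ (a ℕ.+ b)))
  (ℚᵘP.≃-trans (ℚᵘ.*≡* cross) (ℚᵘP.≃-sym (ℚᵘP.≃-trans (QP.toℚᵘ-homo-+ (ι a) (ι b))
    (ℚᵘP.≃-reflexive (cong₂ ℚᵘ._+_ (ι-toℚᵘ a) (ι-toℚᵘ b)))))))
  where
  cross : ℤ.+ (a ℕ.+ b) ℤ.* ℤ.+ 1 ≡ (ℤ.+ a ℤ.* ℤ.+ 1 ℤ.+ ℤ.+ b ℤ.* ℤ.+ 1) ℤ.* ℤ.+ 1
  cross rewrite ℤP.*-identityʳ (ℤ.+ (a ℕ.+ b)) | ℤP.*-identityʳ (ℤ.+ a) | ℤP.*-identityʳ (ℤ.+ b)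
              | ℤP.*-identityʳ (ℤ.+ a ℤ.+ ℤ.+ b) = ℤP.pos-+ a b

ι-* : ∀ a b → ι (a ℕ.* b) ≡ ι a * ι b
ι-* a b = QP.toℚᵘ-injective (ℚᵘP.≃-trans (ℚᵘP.≃-reflexive (ι-toℚᵘ (a ℕ.* b)))
  (ℚᵘP.≃-trans (ℚᵘ.*≡* cross) (ℚᵘP.≃-sym (ℚᵘP.≃-trans (QP.toℚᵘ-homo-* (ι a) (ι b))
    (ℚᵘP.≃-reflexive (cong₂ ℚᵘ._*_ (ι-toℚᵘ a) (ι-toℚᵘ b)))))))
  where
  cross : ℤ.+ (a ℕ.* b) ℤ.* ℤ.+ 1 ≡ (ℤ.+ a ℤ.* ℤ.+ b) ℤ.* ℤ.+ 1
  cross rewrite ℤP.*-identityʳ (ℤ.+ (a ℕ.* b)) | ℤP.*-identityʳ (ℤ.+ a ℤ.* ℤ.+ b) = ℤP.pos-* a b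

ι-suc : ∀ n → ι (suc n) ≡ 1ℚ + ι n
ι-suc = ι-+ 1

ι-injective : ∀ {a b} → ι a ≡ ι b → a ≡ b
ι-injective {a} {b} ιa≡ιb = cong ℤ.∣_∣ (cong ℚᵘ.↥_ (trans (sym (ι-toℚᵘ a)) (trans (cong toℚᵘ ιa≡ιb) (ι-toℚᵘ b))))

ι-suc≢0 : ∀ n → ι (suc n) ≢ 0ℚ
ι-suc≢0 n ι[1+n]≡0 with ι-injective {suc n} {0} ι[1+n]≡0
... | ()

ι-∸ : ∀ a b → b ≤ a → ι (a ∸ b) ≡ ι a - ι b
ι-∸ a b b≤a = begin
  ι (a ∸ b)                ≡⟨ shift (ι (a ∸ b)) (ι b) ⟩
  (ι (a ∸ b) + ι b) - ι b  ≡⟨ cong (_- ι b) (sym (ι-+ (a ∸ b) b)) ⟩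
  ι (a ∸ b ℕ.+ b) - ι b    ≡⟨ cong (λ c → ι c - ι b) (ℕP.m∸n+n≡m b≤a) ⟩
  ι a - ι b                ∎
  where
  open ≡-Reasoning
  shift : ∀ p q → p ≡ (p + q) - q
  shift = solve-∀ ℚ-ring

ι-∸-suc : ∀ {a b} → b ≤ a → ι (a ∸ b) ≡ - (- ι (suc a) + ι (suc b))
ι-∸-suc {a} {b} b≤a = begin
  ι (a ∸ b)                      ≡⟨ ι-∸ a b b≤a ⟩
  ι a - ι b                      ≡⟨ shift (ι a) (ι b) ⟩
  - (- (1ℚ + ι a) + (1ℚ + ι b))  ≡⟨ cong₂ (λ p q → - (- p + q)) (ι-suc a) (ι-suc b) ⟨
  - (- ι (suc a) + ι (suc b))    ∎
  where
  open ≡-Reasoning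
  shift : ∀ a b → a - b ≡ - (- (1ℚ + a) + (1ℚ + b))
  shift = solve-∀ ℚ-ring

ι-≢ : ∀ {a b} → a ≢ b → ι a - ι b ≢ 0ℚ
ι-≢ {a} {b} a≢b ιa-ιb≡0 = a≢b (ι-injective (p-q≡0⇒p≡q (ι a) (ι b) ιa-ιb≡0))

ι-<-≢0 : ∀ {j t} → j < t → ι t - ι j ≢ 0ℚ
ι-<-≢0 j<t = ι-≢ (λ t≡j → ℕP.<-irrefl (sym t≡j) j<t)

ι-*-cong : ∀ a b c d → a ℕ.* b ≡ c ℕ.* d → ι a * ι b ≡ ι c * ι d
ι-*-cong a b c d ab≡cd = trans (sym (ι-* a b)) (trans (cong ι ab≡cd) (ι-* c d))

PoleFree : ℕ → ℚ → Set
PoleFree m x = ∀ j → j ≤ m → x + ι j ≢ 0ℚ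

PoleFree-mono : ∀ {m n x} → n ≤ m → PoleFree m x → PoleFree n x
PoleFree-mono n≤m free j j≤n = free j (ℕP.≤-trans j≤n n≤m)

-ι+ι≢0 : ∀ {j t} → j ≢ t → - ι t + ι j ≢ 0ℚ
-ι+ι≢0 {j} {t} j≢t -t+j≡0 = ι-≢ (λ t≡j → j≢t (sym t≡j)) (trans (flip (ι t) (ι j)) (cong -_ -t+j≡0))
  where
  flip : ∀ a b → a - b ≡ - ((- a) + b)
  flip = solve-∀ ℚ-ring

PoleFree-negative : ∀ {m t} → m < t → PoleFree m (- ι t)
PoleFree-negative m<t j j≤m = -ι+ι≢0 (ℕP.<⇒≢ (ℕP.≤-<-trans j≤m m<t))

sgn*sgn≡1 : ∀ n → sgn n * sgn n ≡ 1ℚ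
sgn*sgn≡1 zero = refl
sgn*sgn≡1 (suc n) = trans (negs (sgn n)) (sgn*sgn≡1 n)
  where
  negs : ∀ s → (- s) * (- s) ≡ s * s
  negs = solve-∀ ℚ-ring

sgn-+ : ∀ a b → sgn (a ℕ.+ b) ≡ sgn a * sgn b
sgn-+ zero b = sym (QP.*-identityˡ (sgn b))
sgn-+ (suc a) b = trans (cong -_ (sgn-+ a b)) (QP.neg-distribˡ-* (sgn a) (sgn b))

sgn-∸ : ∀ {a b} → b ≤ a → sgn (a ∸ b) ≡ sgn a * sgn b
sgn-∸ {a} {b} b≤a = begin
  sgn (a ∸ b)                    ≡⟨ sym (QP.*-identityʳ (sgn (a ∸ b))) ⟩
  sgn (a ∸ b) * 1ℚ               ≡⟨ cong (sgn (a ∸ b) *_) (sym (sgn*sgn≡1 b)) ⟩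
  sgn (a ∸ b) * (sgn b * sgn b)  ≡⟨ sym (QP.*-assoc (sgn (a ∸ b)) (sgn b) (sgn b)) ⟩
  sgn (a ∸ b) * sgn b * sgn b    ≡⟨ cong (_* sgn b) (sym (sgn-+ (a ∸ b) b)) ⟩
  sgn (a ∸ b ℕ.+ b) * sgn b      ≡⟨ cong (λ c → sgn c * sgn b) (ℕP.m∸n+n≡m b≤a) ⟩
  sgn a * sgn b                  ∎
  where open ≡-Reasoning

Σ : ℕ → (ℕ → ℚ) → ℚ
Σ = sumBelow

sum-cong : ∀ N {f g : ℕ → ℚ} → (∀ i → i < N → f i ≡ g i) → Σ N f ≡ Σ N g
sum-cong zero f≡g = refl
sum-cong (suc N) f≡g = cong₂ _+_ (sum-cong N (λ i i<N → f≡g i (ℕP.m<n⇒m<1+n i<N))) (f≡g N ℕP.≤-refl)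

sum-0 : ∀ N → Σ N (λ _ → 0ℚ) ≡ 0ℚ
sum-0 zero = refl
sum-0 (suc N) = cong (_+ 0ℚ) (sum-0 N)

sum-+ : ∀ N (f g : ℕ → ℚ) → Σ N (λ i → f i + g i) ≡ Σ N f + Σ N g
sum-+ zero f g = refl
sum-+ (suc N) f g = trans (cong (_+ (f N + g N)) (sum-+ N f g)) (swap (Σ N f) (Σ N g) (f N) (g N))
  where
  swap : ∀ a b c d → (a + b) + (c + d) ≡ (a + c) + (b + d)
  swap = solve-∀ ℚ-ring

sum-*ˡ : ∀ N c (f : ℕ → ℚ) → Σ N (λ i → c * f i) ≡ c * Σ N f
sum-*ˡ zero c f = sym (QP.*-zeroʳ c)
sum-*ˡ (suc N) c f = trans (cong (_+ (c * f N)) (sum-*ˡ N c f)) (sym (QP.*-distribˡ-+ c (Σ N f) (f N)))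

sum-*ʳ : ∀ N c (f : ℕ → ℚ) → Σ N (λ i → f i * c) ≡ Σ N f * c
sum-*ʳ N c f = trans (sum-cong N (λ i _ → QP.*-comm (f i) c)) (trans (sum-*ˡ N c f) (QP.*-comm c (Σ N f)))

sum-neg : ∀ N (f : ℕ → ℚ) → Σ N (λ i → - f i) ≡ - Σ N f
sum-neg zero f = refl
sum-neg (suc N) f = trans (cong (_+ - f N) (sum-neg N f)) (sym (QP.neg-distrib-+ (Σ N f) (f N)))

sum-linear : ∀ N (f g : ℕ → ℚ) s c → Σ N (λ i → f i * s + c * g i) ≡ Σ N f * s + c * Σ N g
sum-linear N f g s c = trans (sum-+ N (λ i → f i * s) (λ i → c * g i)) (cong₂ _+_ (sum-*ʳ N s f) (sum-*ˡ N c g))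

sum-split : ∀ a b (f : ℕ → ℚ) → Σ (a ℕ.+ b) f ≡ Σ a f + Σ b (λ i → f (a ℕ.+ i))
sum-split a zero f = trans (cong (λ k → Σ k f) (ℕP.+-identityʳ a)) (sym (QP.+-identityʳ (Σ a f)))
sum-split a (suc b) f = begin
  Σ (a ℕ.+ suc b) f                                ≡⟨ cong (λ k → Σ k f) (ℕP.+-suc a b) ⟩
  Σ (a ℕ.+ b) f + f (a ℕ.+ b)                      ≡⟨ cong (_+ f (a ℕ.+ b)) (sum-split a b f) ⟩
  (Σ a f + Σ b (λ i → f (a ℕ.+ i))) + f (a ℕ.+ b)  ≡⟨ QP.+-assoc (Σ a f) _ (f (a ℕ.+ b)) ⟩
  Σ a f + Σ (suc b) (λ i → f (a ℕ.+ i))            ∎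
  where open ≡-Reasoning

sum-unfoldˡ : ∀ N (f : ℕ → ℚ) → Σ (suc N) f ≡ f 0 + Σ N (λ i → f (suc i))
sum-unfoldˡ N f = trans (sum-split 1 N f) (cong (_+ Σ N (λ i → f (suc i))) (QP.+-identityˡ (f 0)))

sum-reverse : ∀ N (f : ℕ → ℚ) → Σ N f ≡ Σ N (λ i → f (N ∸ suc i))
sum-reverse zero f = refl
sum-reverse (suc N) f = begin
  Σ N f + f N                      ≡⟨ cong (_+ f N) (sum-reverse N f) ⟩
  Σ N (λ i → f (N ∸ suc i)) + f N  ≡⟨ QP.+-comm _ (f N) ⟩
  f N + Σ N (λ i → f (N ∸ suc i))  ≡⟨ sym (sum-unfoldˡ N (λ i → f (N ∸ i))) ⟩
  Σ (suc N) (λ i → f (N ∸ i))      ∎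
  where open ≡-Reasoning

sum-swap : ∀ A B (f : ℕ → ℕ → ℚ) → Σ A (λ k → Σ B (f k)) ≡ Σ B (λ j → Σ A (λ k → f k j))
sum-swap zero B f = sym (sum-0 B)
sum-swap (suc A) B f =
  trans (cong (_+ Σ B (f A)) (sum-swap A B f)) (sym (sum-+ B (λ j → Σ A (λ k → f k j)) (f A)))

sum-*-sum : ∀ A B (f g : ℕ → ℚ) → Σ A f * Σ B g ≡ Σ A (λ k → Σ B (λ j → f k * g j))
sum-*-sum A B f g = sym (begin
  Σ A (λ k → Σ B (λ j → f k * g j))  ≡⟨ sum-cong A (λ k _ → sum-*ˡ B (f k) g) ⟩
  Σ A (λ k → f k * Σ B g)            ≡⟨ sum-*ʳ A (Σ B g) f ⟩
  Σ A f * Σ B g                      ∎)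
  where open ≡-Reasoning

sum-single : ∀ N k (f : ℕ → ℚ) → k < N → (∀ j → j < N → j ≢ k → f j ≡ 0ℚ) → Σ N f ≡ f k
sum-single (suc N) k f k<1+N off with k ℕP.≟ N
... | yes refl = trans (cong (_+ f k) rest≡0) (QP.+-identityˡ (f k))
  where
  rest≡0 : Σ N f ≡ 0ℚ
  rest≡0 = trans (sum-cong N (λ i i<N → off i (ℕP.m<n⇒m<1+n i<N) (λ i≡N → ℕP.<-irrefl i≡N i<N))) (sum-0 N)
... | no k≢N = trans (cong₂ _+_ (sum-single N k f k<N (λ j j<N → off j (ℕP.m<n⇒m<1+n j<N)))
                                (off N ℕP.≤-refl (λ N≡k → k≢N (sym N≡k))))
                     (QP.+-identityʳ (f k))
  where
  k<N : k < N
  k<N = ℕP.≤∧≢⇒< (ℕP.≤-pred k<1+N) k≢N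

[1+n]C[1+k]*[1+k]≡[1+n]*nCk : ∀ n k → (suc n C suc k) ℕ.* suc k ≡ suc n ℕ.* (n C k)
[1+n]C[1+k]*[1+k]≡[1+n]*nCk zero zero = refl
[1+n]C[1+k]*[1+k]≡[1+n]*nCk zero (suc k) = refl
[1+n]C[1+k]*[1+k]≡[1+n]*nCk (suc n) zero = cong (ℕ._* 1) (nC1≡n (suc (suc n)))
[1+n]C[1+k]*[1+k]≡[1+n]*nCk (suc n) (suc k) = begin
  (suc (suc n) C suc (suc k)) ℕ.* suc (suc k)       ≡⟨ cong (ℕ._* suc (suc k)) (sym (nCk+nC[k+1]≡[n+1]C[k+1] (suc n) (suc k))) ⟩
  (X ℕ.+ Y) ℕ.* suc (suc k)                          ≡⟨ expand X Y k ⟩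
  X ℕ.* suc k ℕ.+ X ℕ.+ Y ℕ.* suc (suc k)            ≡⟨ cong₂ (λ a b → a ℕ.+ X ℕ.+ b) ([1+n]C[1+k]*[1+k]≡[1+n]*nCk n k) ([1+n]C[1+k]*[1+k]≡[1+n]*nCk n (suc k)) ⟩
  suc n ℕ.* (n C k) ℕ.+ X ℕ.+ suc n ℕ.* (n C suc k)  ≡⟨ collect n (n C k) X (n C suc k) ⟩
  suc n ℕ.* ((n C k) ℕ.+ (n C suc k)) ℕ.+ X          ≡⟨ cong (λ z → suc n ℕ.* z ℕ.+ X) (nCk+nC[k+1]≡[n+1]C[k+1] n k) ⟩
  suc n ℕ.* X ℕ.+ X                                  ≡⟨ ℕP.+-comm (suc n ℕ.* X) X ⟩
  suc (suc n) ℕ.* X                                  ∎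
  where
  open ≡-Reasoning
  X = suc n C suc k
  Y = suc n C suc (suc k)
  expand : ∀ X Y k → (X ℕ.+ Y) ℕ.* suc (suc k) ≡ X ℕ.* suc k ℕ.+ X ℕ.+ Y ℕ.* suc (suc k)
  expand = ℕSolver.solve-∀
  collect : ∀ n a X b → suc n ℕ.* a ℕ.+ X ℕ.+ suc n ℕ.* b ≡ suc n ℕ.* (a ℕ.+ b) ℕ.+ X
  collect = ℕSolver.solve-∀

nC[1+k]*[1+k]≡nCk*[n∸k] : ∀ n k → (n C suc k) ℕ.* suc k ≡ (n C k) ℕ.* (n ∸ k)
nC[1+k]*[1+k]≡nCk*[n∸k] n k = begin
  P ℕ.* suc k                                  ≡⟨ sym (ℕP.m+n∸m≡n (Q ℕ.* suc k) (P ℕ.* suc k)) ⟩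
  (Q ℕ.* suc k ℕ.+ P ℕ.* suc k) ∸ Q ℕ.* suc k  ≡⟨ cong (_∸ Q ℕ.* suc k) (sym (ℕP.*-distribʳ-+ (suc k) Q P)) ⟩
  (Q ℕ.+ P) ℕ.* suc k ∸ Q ℕ.* suc k            ≡⟨ cong (λ z → z ℕ.* suc k ∸ Q ℕ.* suc k) (nCk+nC[k+1]≡[n+1]C[k+1] n k) ⟩
  (suc n C suc k) ℕ.* suc k ∸ Q ℕ.* suc k      ≡⟨ cong (_∸ Q ℕ.* suc k) ([1+n]C[1+k]*[1+k]≡[1+n]*nCk n k) ⟩
  suc n ℕ.* Q ∸ Q ℕ.* suc k                    ≡⟨ cong (_∸ Q ℕ.* suc k) (ℕP.*-comm (suc n) Q) ⟩
  Q ℕ.* suc n ∸ Q ℕ.* suc k                    ≡⟨ sym (ℕP.*-distribˡ-∸ Q (suc n) (suc k)) ⟩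
  Q ℕ.* (n ∸ k)                                ∎
  where
  open ≡-Reasoning
  P = n C suc k
  Q = n C k

[1+n]Ck*[1+n∸k]≡[1+n]*nCk : ∀ n k → (suc n C k) ℕ.* (suc n ∸ k) ≡ suc n ℕ.* (n C k)
[1+n]Ck*[1+n∸k]≡[1+n]*nCk n k = trans (sym (nC[1+k]*[1+k]≡nCk*[n∸k] (suc n) k)) ([1+n]C[1+k]*[1+k]≡[1+n]*nCk n k)

k≤n⇒nCk≢0 : ∀ {k n} → k ≤ n → n C k ≢ 0
k≤n⇒nCk≢0 {zero} _ ()
k≤n⇒nCk≢0 {suc k} {suc n} (s≤s k≤n) [1+n]C[1+k]≡0 =
  k≤n⇒nCk≢0 k≤n (ℕP.m+n≡0⇒m≡0 (n C k) (trans (nCk+nC[k+1]≡[n+1]C[k+1] n k) [1+n]C[1+k]≡0))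

ι-nC[1+k]*[1+k] : ∀ n k → ι (n C suc k) * ι (suc k) ≡ ι (n C k) * ι (n ∸ k)
ι-nC[1+k]*[1+k] n k = ι-*-cong (n C suc k) (suc k) (n C k) (n ∸ k) (nC[1+k]*[1+k]≡nCk*[n∸k] n k)

ι-[1+n]Ck*[1+n∸k] : ∀ n k → ι (suc n C k) * ι (suc n ∸ k) ≡ ι (suc n) * ι (n C k)
ι-[1+n]Ck*[1+n∸k] n k = ι-*-cong (suc n C k) (suc n ∸ k) (suc n) (n C k) ([1+n]Ck*[1+n∸k]≡[1+n]*nCk n k)

ι-[1+a+b]Cb*[1+a] : ∀ a b → ι ((suc a ℕ.+ b) C b) * ι (suc a) ≡ (ι (suc a) + ι b) * ι ((a ℕ.+ b) C b)
ι-[1+a+b]Cb*[1+a] a b = begin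
  ι ((suc a ℕ.+ b) C b) * ι (suc a)            ≡⟨ cong (λ z → ι ((suc a ℕ.+ b) C b) * ι z) (ℕP.m+n∸n≡m (suc a) b) ⟨
  ι ((suc a ℕ.+ b) C b) * ι (suc a ℕ.+ b ∸ b)  ≡⟨ ι-[1+n]Ck*[1+n∸k] (a ℕ.+ b) b ⟩
  ι (suc a ℕ.+ b) * ι ((a ℕ.+ b) C b)          ≡⟨ cong (_* ι ((a ℕ.+ b) C b)) (ι-+ (suc a) b) ⟩
  (ι (suc a) + ι b) * ι ((a ℕ.+ b) C b)        ∎
  where open ≡-Reasoning

-- Partial fractions of (1-x)_m / (x)_{m+1}

pochRatio : ℕ → ℚ → ℚ
pochRatio m x = poch (1ℚ - x) m * inv (poch x (suc m))

coeff : ℕ → ℕ → ℚ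
coeff m j = ι (((m ℕ.+ j) C j) ℕ.* (m C j))

res : ℕ → ℕ → ℚ
res m j = sgn j * coeff m j

partialFractions : ℕ → ℚ → ℚ
partialFractions m x = Σ (suc m) (λ j → res m j * inv (x + ι j))

-- Σ_{j ≠ k} res m j / (k - j); the summand j = k vanishes because inv 0 = 0.
regularPart : ℕ → ℕ → ℚ
regularPart m k = Σ (suc m) (λ j → res m j * inv (ι k - ι j))

PartialFractions : ℕ → Set
PartialFractions m = ∀ x → PoleFree m x → pochRatio m x ≡ partialFractions m x

pochRatio-suc : ∀ m x → pochRatio (suc m) x ≡ pochRatio m x * ((ι (suc m) - x) * inv (x + ι (suc m)))
pochRatio-suc m x = begin
  a * ((1ℚ - x) + ι m) * inv (b * (x + M))    ≡⟨ cong (a * ((1ℚ - x) + ι m) *_) (inv-* b (x + M)) ⟩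
  a * ((1ℚ - x) + ι m) * (inv b * inv (x + M))  ≡⟨ regroup a (inv b) (inv (x + M)) x (ι m) ⟩
  a * inv b * (((1ℚ + ι m) - x) * inv (x + M))  ≡⟨ cong (λ z → a * inv b * ((z - x) * inv (x + M))) (sym (ι-suc m)) ⟩
  a * inv b * ((M - x) * inv (x + M))           ∎
  where
  open ≡-Reasoning
  a = poch (1ℚ - x) m
  b = poch x (suc m)
  M = ι (suc m)
  regroup : ∀ a A B x t → a * ((1ℚ - x) + t) * (A * B) ≡ (a * A) * (((1ℚ + t) - x) * B)
  regroup = solve-∀ ℚ-ring

coeff-suc : ∀ {m j} → j ≤ m → coeff (suc m) j * (ι (suc m) - ι j) ≡ coeff m j * (ι (suc m) + ι j)
coeff-suc {m} {j} j≤m = *-cancelʳ-≢0 _ _ (ι M) (ι-suc≢0 m) (begin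
  coeff M j * (ι M - ι j) * ι M              ≡⟨ cong (λ z → z * (ι M - ι j) * ι M) (ι-* X Y) ⟩
  ι X * ι Y * (ι M - ι j) * ι M              ≡⟨ cong (λ z → ι X * ι Y * z * ι M) (sym (ι-∸ M j (ℕP.m≤n⇒m≤1+n j≤m))) ⟩
  ι X * ι Y * ι (M ∸ j) * ι M                ≡⟨ regroup (ι X) (ι Y) (ι (M ∸ j)) (ι M) ⟩
  (ι X * ι M) * (ι Y * ι (M ∸ j))            ≡⟨ cong₂ _*_ (ι-[1+a+b]Cb*[1+a] m j) (ι-[1+n]Ck*[1+n∸k] m j) ⟩
  ((ι M + ι j) * ι X′) * (ι M * ι Y′)        ≡⟨ regroup′ (ι M) (ι j) (ι X′) (ι Y′) ⟩
  (ι X′ * ι Y′) * (ι M + ι j) * ι M          ≡⟨ cong (λ z → z * (ι M + ι j) * ι M) (sym (ι-* X′ Y′)) ⟩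
  coeff m j * (ι M + ι j) * ι M              ∎)
  where
  open ≡-Reasoning
  M = suc m
  X = (M ℕ.+ j) C j
  Y = M C j
  X′ = (m ℕ.+ j) C j
  Y′ = m C j
  regroup : ∀ a b c d → a * b * c * d ≡ (a * d) * (b * c)
  regroup = solve-∀ ℚ-ring
  regroup′ : ∀ M j a b → ((M + j) * a) * (M * b) ≡ (a * b) * (M + j) * M
  regroup′ = solve-∀ ℚ-ring

res-suc : ∀ {m j} → j ≤ m → res (suc m) j ≡ res m j * (ι (suc m) + ι j) * inv (ι (suc m) - ι j)
res-suc {m} {j} j≤m = begin
  sgn j * coeff M j                                  ≡⟨ cong (sgn j *_) (sym (QP.*-identityʳ (coeff M j))) ⟩
  sgn j * (coeff M j * 1ℚ)                           ≡⟨ cong (λ z → sgn j * (coeff M j * z)) (sym (inv-inverseʳ (ι M - ι j) (ι-<-≢0 (s≤s j≤m)))) ⟩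
  sgn j * (coeff M j * ((ι M - ι j) * i))            ≡⟨ cong (sgn j *_) (sym (QP.*-assoc (coeff M j) (ι M - ι j) i)) ⟩
  sgn j * (coeff M j * (ι M - ι j) * i)              ≡⟨ cong (λ z → sgn j * (z * i)) (coeff-suc j≤m) ⟩
  sgn j * (coeff m j * (ι M + ι j) * i)              ≡⟨ regroup (sgn j) (coeff m j) (ι M + ι j) i ⟩
  sgn j * coeff m j * (ι M + ι j) * i                ∎
  where
  open ≡-Reasoning
  M = suc m
  i = inv (ι M - ι j)
  regroup : ∀ s c u i → s * (c * u * i) ≡ s * c * u * i
  regroup = solve-∀ ℚ-ring

-- In the induction step pochRatio gains the factor (n+1+J)/(n+1-J) and C(t, ·) the factor (t-n)/(n+1).
pochRatio-at-negative : ∀ n t → n ≤ t →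
  ι (suc t) * ι (t C n) * pochRatio n (- ι (suc t)) ≡ sgn (suc n) * ι ((n ℕ.+ suc t) C suc t)
pochRatio-at-negative zero t _ = begin
  J * 1ℚ * (1ℚ * inv (1ℚ * (- J + 0ℚ)))  ≡⟨ cong (λ z → J * 1ℚ * (1ℚ * inv z)) (unit J) ⟩
  J * 1ℚ * (1ℚ * inv (- J))              ≡⟨ cong (λ z → J * 1ℚ * (1ℚ * z)) (inv-neg J) ⟩
  J * 1ℚ * (1ℚ * - inv J)                ≡⟨ regroup J (inv J) ⟩
  - 1ℚ * (J * inv J)                     ≡⟨ cong (- 1ℚ *_) (inv-inverseʳ J (ι-suc≢0 t)) ⟩
  - 1ℚ * 1ℚ                              ≡⟨ cong (λ z → - 1ℚ * ι z) (sym (nCn≡1 (suc t))) ⟩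
  - 1ℚ * ι (suc t C suc t)               ∎
  where
  open ≡-Reasoning
  J = ι (suc t)
  unit : ∀ J → 1ℚ * (- J + 0ℚ) ≡ - J
  unit = solve-∀ ℚ-ring
  regroup : ∀ J i → J * 1ℚ * (1ℚ * - i) ≡ - 1ℚ * (J * i)
  regroup = solve-∀ ℚ-ring
pochRatio-at-negative (suc n) t 1+n≤t = *-cancelʳ-≢0 _ _ N (ι-suc≢0 n) (begin
  J * ι (t C suc n) * pochRatio (suc n) y * N      ≡⟨ cong (λ z → J * ι (t C suc n) * z * N) (pochRatio-suc n y) ⟩
  J * ι (t C suc n) * (p * ((N - y) * inv D)) * N  ≡⟨ regroup₁ J (ι (t C suc n)) p (N - y) (inv D) N ⟩
  J * p * (N - y) * inv D * (ι (t C suc n) * N)    ≡⟨ cong (J * p * (N - y) * inv D *_) (ι-nC[1+k]*[1+k] t n) ⟩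
  J * p * (N - y) * inv D * (ι (t C n) * ι (t ∸ n)) ≡⟨ cong (λ z → J * p * (N - y) * inv D * (ι (t C n) * z)) (ι-∸-suc n≤t) ⟩
  J * p * (N - y) * inv D * (ι (t C n) * - D)      ≡⟨ regroup₂ J p (N - y) (inv D) (ι (t C n)) D ⟩
  - (N - y) * (J * ι (t C n) * p) * (D * inv D)    ≡⟨ cong₂ (λ a b → - (N - y) * a * b) (pochRatio-at-negative n t n≤t) (inv-inverseʳ D D≢0) ⟩
  - (N - y) * (sgn (suc n) * K) * 1ℚ               ≡⟨ regroup₃ N J (sgn (suc n)) K ⟩
  - sgn (suc n) * ((N + J) * K)                    ≡⟨ cong (- sgn (suc n) *_) (ι-[1+a+b]Cb*[1+a] n (suc t)) ⟨
  - sgn (suc n) * (ι K′ * N)                       ≡⟨ QP.*-assoc (- sgn (suc n)) (ι K′) N ⟨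
  - sgn (suc n) * ι K′ * N                         ∎)
  where
  open ≡-Reasoning
  n≤t = ℕP.≤-trans (ℕP.n≤1+n n) 1+n≤t
  J = ι (suc t)
  N = ι (suc n)
  y = - J
  p = pochRatio n y
  D = y + N
  K = ι ((n ℕ.+ suc t) C suc t)
  K′ = (suc n ℕ.+ suc t) C suc t
  D≢0 : D ≢ 0ℚ
  D≢0 = -ι+ι≢0 (ℕP.<⇒≢ (s≤s 1+n≤t))
  regroup₁ : ∀ J c p u i N → J * c * (p * (u * i)) * N ≡ J * p * u * i * (c * N)
  regroup₁ = solve-∀ ℚ-ring
  regroup₂ : ∀ J p u i c D → J * p * u * i * (c * - D) ≡ - u * (J * c * p) * (D * i)
  regroup₂ = solve-∀ ℚ-ring
  regroup₃ : ∀ N J s K → - (N - - J) * (s * K) * 1ℚ ≡ - s * ((N + J) * K)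
  regroup₃ = solve-∀ ℚ-ring

regularPart-beyond : ∀ {m t} → PartialFractions m → m < t → regularPart m t ≡ - pochRatio m (- ι t)
regularPart-beyond {m} {t} pf m<t = begin
  Σ (suc m) (λ j → res m j * inv (ι t - ι j))       ≡⟨ sum-cong (suc m) (λ j _ → cong (res m j *_) (inv-[a-b]≡-inv-[-a+b] (ι t) (ι j))) ⟩
  Σ (suc m) (λ j → res m j * - inv (- ι t + ι j))   ≡⟨ sum-cong (suc m) (λ j _ → QP.neg-distribʳ-* (res m j) _) ⟨
  Σ (suc m) (λ j → - (res m j * inv (- ι t + ι j))) ≡⟨ sum-neg (suc m) _ ⟩
  - partialFractions m (- ι t)                      ≡⟨ cong -_ (pf (- ι t) (PoleFree-negative m<t)) ⟨
  - pochRatio m (- ι t)                             ∎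
  where open ≡-Reasoning

res-diagonal : ∀ m → PartialFractions m → res (suc m) (suc m) ≡ (ι (suc m) + ι (suc m)) * pochRatio m (- ι (suc m))
res-diagonal m pf = *-cancelʳ-≢0 _ _ M (ι-suc≢0 m) (begin
  sgn (suc m) * ι (K₂ ℕ.* (suc m C suc m)) * M  ≡⟨ cong (λ z → sgn (suc m) * ι (K₂ ℕ.* z) * M) (nCn≡1 (suc m)) ⟩
  sgn (suc m) * ι (K₂ ℕ.* 1) * M                ≡⟨ cong (λ z → sgn (suc m) * ι z * M) (ℕP.*-identityʳ K₂) ⟩
  sgn (suc m) * ι K₂ * M                        ≡⟨ QP.*-assoc (sgn (suc m)) (ι K₂) M ⟩
  sgn (suc m) * (ι K₂ * M)                      ≡⟨ cong (sgn (suc m) *_) (ι-[1+a+b]Cb*[1+a] m (suc m)) ⟩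
  sgn (suc m) * ((M + M) * ι K)                 ≡⟨ cong (λ z → sgn (suc m) * ((M + M) * z)) K≡ ⟩
  sgn (suc m) * ((M + M) * (sgn (suc m) * (M * p))) ≡⟨ regroup (sgn (suc m)) M p ⟩
  (sgn (suc m) * sgn (suc m)) * ((M + M) * p * M) ≡⟨ cong (_* ((M + M) * p * M)) (sgn*sgn≡1 (suc m)) ⟩
  1ℚ * ((M + M) * p * M)                        ≡⟨ QP.*-identityˡ _ ⟩
  (M + M) * p * M                               ∎)
  where
  open ≡-Reasoning
  M = ι (suc m)
  p = pochRatio m (- M)
  K = (m ℕ.+ suc m) C suc m
  K₂ = (suc m ℕ.+ suc m) C suc m
  closed : M * ι (m C m) * p ≡ sgn (suc m) * ι K
  closed = pochRatio-at-negative m m ℕP.≤-refl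
  K≡ : ι K ≡ sgn (suc m) * (M * p)
  K≡ = begin
    ι K                                    ≡⟨ sym (QP.*-identityˡ (ι K)) ⟩
    1ℚ * ι K                               ≡⟨ cong (_* ι K) (sym (sgn*sgn≡1 (suc m))) ⟩
    sgn (suc m) * sgn (suc m) * ι K        ≡⟨ QP.*-assoc (sgn (suc m)) (sgn (suc m)) (ι K) ⟩
    sgn (suc m) * (sgn (suc m) * ι K)      ≡⟨ cong (sgn (suc m) *_) (sym closed) ⟩
    sgn (suc m) * (M * ι (m C m) * p)      ≡⟨ cong (λ z → sgn (suc m) * (M * ι z * p)) (nCn≡1 m) ⟩
    sgn (suc m) * (M * 1ℚ * p)             ≡⟨ cong (λ z → sgn (suc m) * (z * p)) (QP.*-identityʳ M) ⟩
    sgn (suc m) * (M * p)                  ∎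
  regroup : ∀ s M p → s * ((M + M) * (s * (M * p))) ≡ (s * s) * ((M + M) * p * M)
  regroup = solve-∀ ℚ-ring

-- The coefficient of 1/(x+m+1) left over when partialFractions m x * (m+1-x)/(x+m+1) is re-expanded.
res-balance : ∀ m → PartialFractions m → (ι (suc m) + ι (suc m)) * regularPart m (suc m) + res (suc m) (suc m) ≡ 0ℚ
res-balance m pf = begin
  (M + M) * regularPart m (suc m) + res (suc m) (suc m)  ≡⟨ cong₂ (λ a b → (M + M) * a + b) (regularPart-beyond pf ℕP.≤-refl) (res-diagonal m pf) ⟩
  (M + M) * - p + (M + M) * p                            ≡⟨ cancel (M + M) p ⟩
  0ℚ                                                     ∎
  where
  open ≡-Reasoning
  M = ι (suc m)
  p = pochRatio m (- M)
  cancel : ∀ a p → a * - p + a * p ≡ 0ℚ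
  cancel = solve-∀ ℚ-ring

split-[M+j]/[M-j][x+j] : ∀ x j M → x + j ≢ 0ℚ → M - j ≢ 0ℚ → x + M ≢ 0ℚ →
  (M + j) * inv (M - j) * inv (x + j) ≡ inv (x + j) * (M - x) * inv (x + M) + (M + M) * inv (M - j) * inv (x + M)
split-[M+j]/[M-j][x+j] x j M x+j≢0 M-j≢0 x+M≢0 =
  ≡-modulo-inverses _ _ ((M + j) * a * b) (- ((M - x) * a * c)) (- ((M + M) * b * c)) _ _ _
    (certificate x j M a b c) (inv-inverseʳ _ x+M≢0) (inv-inverseʳ _ M-j≢0) (inv-inverseʳ _ x+j≢0)
  where
  a = inv (x + j)
  b = inv (M - j)
  c = inv (x + M)
  certificate : ∀ x j M a b c →
    (M + j) * b * a - (a * (M - x) * c + (M + M) * b * c)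
      ≡ ((M + j) * a * b) * (1ℚ - (x + M) * c) + (- ((M - x) * a * c)) * (1ℚ - (M - j) * b)
        + (- ((M + M) * b * c)) * (1ℚ - (x + j) * a)
  certificate = solve-∀ ℚ-ring

partialFractions-suc : ∀ m x → PoleFree (suc m) x →
  (ι (suc m) + ι (suc m)) * regularPart m (suc m) + res (suc m) (suc m) ≡ 0ℚ →
  partialFractions (suc m) x ≡ partialFractions m x * ((ι (suc m) - x) * inv (x + ι (suc m)))
partialFractions-suc m x free balance = begin
  Σ (suc m) (λ j → res M j * inv (x + ι j)) + res M M * c         ≡⟨ cong (_+ res M M * c) (sum-cong (suc m) term) ⟩
  Σ (suc m) (λ j → old j * s + (ι M + ι M) * c * r j) + res M M * c ≡⟨ cong (_+ res M M * c) (sum-linear (suc m) old r s ((ι M + ι M) * c)) ⟩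
  partialFractions m x * s + (ι M + ι M) * c * regularPart m M + res M M * c ≡⟨ collect (partialFractions m x * s) c (ι M) (regularPart m M) (res M M) ⟩
  partialFractions m x * s + c * ((ι M + ι M) * regularPart m M + res M M) ≡⟨ cong (λ z → partialFractions m x * s + c * z) balance ⟩
  partialFractions m x * s + c * 0ℚ                               ≡⟨ drop (partialFractions m x * s) c ⟩
  partialFractions m x * s                                        ∎
  where
  open ≡-Reasoning
  M = suc m
  c = inv (x + ι M)
  s = (ι M - x) * c
  old r : ℕ → ℚ
  old j = res m j * inv (x + ι j)
  r j = res m j * inv (ι M - ι j)
  term : ∀ j → j < suc m → res M j * inv (x + ι j) ≡ old j * s + (ι M + ι M) * c * r j
  term j j<1+m = begin
    res M j * inv (x + ι j)                                 ≡⟨ cong (_* inv (x + ι j)) (res-suc j≤m) ⟩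
    res m j * (ι M + ι j) * inv (ι M - ι j) * inv (x + ι j) ≡⟨ regroup₁ (res m j) (ι M + ι j) (inv (ι M - ι j)) (inv (x + ι j)) ⟩
    res m j * ((ι M + ι j) * inv (ι M - ι j) * inv (x + ι j)) ≡⟨ cong (res m j *_) (split-[M+j]/[M-j][x+j] x (ι j) (ι M) (free j (ℕP.m≤n⇒m≤1+n j≤m)) (ι-<-≢0 j<1+m) (free M ℕP.≤-refl)) ⟩
    res m j * (inv (x + ι j) * (ι M - x) * c + (ι M + ι M) * inv (ι M - ι j) * c) ≡⟨ regroup₂ (res m j) (inv (x + ι j)) (ι M - x) c (ι M + ι M) (inv (ι M - ι j)) ⟩
    old j * s + (ι M + ι M) * c * r j                       ∎
    where
    j≤m = ℕP.≤-pred j<1+m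
    regroup₁ : ∀ r u i a → r * u * i * a ≡ r * (u * i * a)
    regroup₁ = solve-∀ ℚ-ring
    regroup₂ : ∀ r a u c T b → r * (a * u * c + T * b * c) ≡ (r * a) * (u * c) + T * c * (r * b)
    regroup₂ = solve-∀ ℚ-ring
  collect : ∀ g c M R W → g + (M + M) * c * R + W * c ≡ g + c * ((M + M) * R + W)
  collect = solve-∀ ℚ-ring
  drop : ∀ g c → g + c * 0ℚ ≡ g
  drop = solve-∀ ℚ-ring

pochRatio≡partialFractions : ∀ m → PartialFractions m
pochRatio≡partialFractions zero x _ = base x
  where
  base : ∀ x → 1ℚ * inv (1ℚ * (x + 0ℚ)) ≡ 0ℚ + 1ℚ * 1ℚ * inv (x + 0ℚ)
  base x = trans (cong (λ z → 1ℚ * inv z) (QP.*-identityˡ (x + 0ℚ))) (lift (inv (x + 0ℚ)))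
    where
    lift : ∀ i → 1ℚ * i ≡ 0ℚ + 1ℚ * 1ℚ * i
    lift = solve-∀ ℚ-ring
pochRatio≡partialFractions (suc m) x free = begin
  pochRatio (suc m) x          ≡⟨ pochRatio-suc m x ⟩
  pochRatio m x * s            ≡⟨ cong (_* s) (IH x (PoleFree-mono {x = x} (ℕP.n≤1+n m) free)) ⟩
  partialFractions m x * s     ≡⟨ partialFractions-suc m x free (res-balance m IH) ⟨
  partialFractions (suc m) x   ∎
  where
  open ≡-Reasoning
  IH = pochRatio≡partialFractions m
  s = (ι (suc m) - x) * inv (x + ι (suc m))

res-balanced : ∀ m → (ι (suc m) + ι (suc m)) * regularPart m (suc m) + res (suc m) (suc m) ≡ 0ℚ
res-balanced m = res-balance m (pochRatio≡partialFractions m)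

sum-≡-except : ∀ N k (f g : ℕ → ℚ) → k < N → (∀ j → j < N → j ≢ k → f j ≡ g j) → Σ N f ≡ Σ N g + (f k - g k)
sum-≡-except N k f g k<N f≡g = begin
  Σ N f                              ≡⟨ sum-cong N (λ j _ → split (f j) (g j)) ⟩
  Σ N (λ j → g j + (f j - g j))      ≡⟨ sum-+ N g (λ j → f j - g j) ⟩
  Σ N g + Σ N (λ j → f j - g j)      ≡⟨ cong (Σ N g +_) (sum-single N k (λ j → f j - g j) k<N off) ⟩
  Σ N g + (f k - g k)                ∎
  where
  open ≡-Reasoning
  split : ∀ a b → a ≡ b + (a - b)
  split = solve-∀ ℚ-ring
  off : ∀ j → j < N → j ≢ k → f j - g j ≡ 0ℚ
  off j j<N j≢k = trans (cong (_- g j) (f≡g j j<N j≢k)) (QP.+-inverseʳ (g j))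

inv-ι-self : ∀ k → inv (ι k - ι k) ≡ 0ℚ
inv-ι-self k = cong inv (QP.+-inverseʳ (ι k))

-- The derivative identity

ZeroFree : ℕ → ℚ → Set
ZeroFree m y = ∀ i → i < m → ι (suc i) - y ≢ 0ℚ

ZeroFree-negative : ∀ m t → ZeroFree m (- ι t)
ZeroFree-negative m t i _ i+1+t≡0 = ι-suc≢0 (i ℕ.+ t) (trans (ι-+ (suc i) t) (trans (minus-neg (ι (suc i)) (ι t)) i+1+t≡0))
  where
  minus-neg : ∀ a b → a + b ≡ a - - b
  minus-neg = solve-∀ ℚ-ring

-- Minus the derivatives of partialFractions m y and of log (pochRatio m y); the identity
-- pfDeriv ≡ partialFractions * logDeriv below is g′ = g · (log g)′, proved without derivatives.
pfDeriv : ℕ → ℚ → ℚ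
pfDeriv m y = Σ (suc m) (λ j → res m j * (inv (y + ι j) * inv (y + ι j)))

logDeriv : ℕ → ℚ → ℚ
logDeriv m y = Σ m (λ i → inv (ι (suc i) - y)) + Σ (suc m) (λ i → inv (y + ι i))

split-[M+j]/[M-j][y+j]² : ∀ y j M → y + j ≢ 0ℚ → M - j ≢ 0ℚ → y + M ≢ 0ℚ →
  (M + j) * inv (M - j) * (inv (y + j) * inv (y + j))
    ≡ (inv (y + j) * inv (y + j)) * ((M - y) * inv (y + M))
      + (M + M) * inv (y + M) * inv (y + M) * inv (y + j) + (M + M) * inv (y + M) * inv (y + M) * inv (M - j)
split-[M+j]/[M-j][y+j]² y j M y+j≢0 M-j≢0 y+M≢0 =
  ≡-modulo-inverses _ _ (t₁ + t₁ * ((y + M) * c) + t₂ * ((M - j) * b)) (t₂ + t₃ * ((y + j) * a)) (t₃ + t₄ + t₄ * ((y + j) * a)) _ _ _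
    (certificate y j M a b c) (inv-inverseʳ _ y+M≢0) (inv-inverseʳ _ M-j≢0) (inv-inverseʳ _ y+j≢0)
  where
  a = inv (y + j)
  b = inv (M - j)
  c = inv (y + M)
  t₁ = (M + j) * b * a * a
  t₂ = - ((M - y) * a * a * c)
  t₃ = - ((M + M) * a * c * c)
  t₄ = - ((M + M) * b * c * c)
  certificate : ∀ y j M a b c →
    (M + j) * b * (a * a) - ((a * a) * ((M - y) * c) + (M + M) * c * c * a + (M + M) * c * c * b)
      ≡ ((M + j) * b * a * a + (M + j) * b * a * a * ((y + M) * c) + (- ((M - y) * a * a * c)) * ((M - j) * b)) * (1ℚ - (y + M) * c)
        + ((- ((M - y) * a * a * c)) + (- ((M + M) * a * c * c)) * ((y + j) * a)) * (1ℚ - (M - j) * b)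
        + ((- ((M + M) * a * c * c)) + (- ((M + M) * b * c * c)) + (- ((M + M) * b * c * c)) * ((y + j) * a)) * (1ℚ - (y + j) * a)
  certificate = solve-∀ ℚ-ring

split-[M+M]/[y+M]² : ∀ y M → y + M ≢ 0ℚ → M - y ≢ 0ℚ →
  (M + M) * inv (y + M) * inv (y + M) ≡ ((M - y) * inv (y + M)) * (inv (M - y) + inv (y + M))
split-[M+M]/[y+M]² y M y+M≢0 M-y≢0 =
  ≡-modulo-inverses _ _ ((M + M) * c * c + (- ((M - y) * c * c))) (- ((M - y) * c * d)) 0ℚ _ _ 1ℚ
    (certificate y M c d) (inv-inverseʳ _ M-y≢0) (inv-inverseʳ _ y+M≢0) refl
  where
  c = inv (y + M)
  d = inv (M - y)
  certificate : ∀ y M c d → (M + M) * c * c - ((M - y) * c) * (d + c)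
    ≡ ((M + M) * c * c + (- ((M - y) * c * c))) * (1ℚ - (M - y) * d) + (- ((M - y) * c * d)) * (1ℚ - (y + M) * c)
      + 0ℚ * (1ℚ - 1ℚ)
  certificate = solve-∀ ℚ-ring

pfDeriv-suc : ∀ m y → PoleFree (suc m) y →
  let M = ι (suc m); c = inv (y + M) in
  pfDeriv (suc m) y ≡ pfDeriv m y * ((M - y) * c) + (M + M) * c * c * (partialFractions m y + regularPart m (suc m))
                      + res (suc m) (suc m) * (c * c)
pfDeriv-suc m y free = begin
  Σ (suc m) new + W                                          ≡⟨ cong (_+ W) (sum-cong (suc m) term) ⟩
  Σ (suc m) (λ j → sq j * s + T * (old j + r j)) + W         ≡⟨ cong (_+ W) (sum-linear (suc m) sq (λ j → old j + r j) s T) ⟩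
  pfDeriv m y * s + T * Σ (suc m) (λ j → old j + r j) + W    ≡⟨ cong (λ z → pfDeriv m y * s + T * z + W) (sum-+ (suc m) old r) ⟩
  pfDeriv m y * s + T * (partialFractions m y + regularPart m (suc m)) + W ∎
  where
  open ≡-Reasoning
  M = ι (suc m)
  c = inv (y + M)
  s = (M - y) * c
  T = (M + M) * c * c
  W = res (suc m) (suc m) * (c * c)
  new sq old r : ℕ → ℚ
  new j = res (suc m) j * (inv (y + ι j) * inv (y + ι j))
  sq j = res m j * (inv (y + ι j) * inv (y + ι j))
  old j = res m j * inv (y + ι j)
  r j = res m j * inv (M - ι j)
  term : ∀ j → j < suc m → new j ≡ sq j * s + T * (old j + r j)
  term j j<1+m = begin
    res (suc m) j * (a * a)                      ≡⟨ cong (_* (a * a)) (res-suc j≤m) ⟩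
    res m j * (M + ι j) * inv (M - ι j) * (a * a) ≡⟨ regroup₁ (res m j) (M + ι j) (inv (M - ι j)) (a * a) ⟩
    res m j * ((M + ι j) * inv (M - ι j) * (a * a)) ≡⟨ cong (res m j *_) (split-[M+j]/[M-j][y+j]² y (ι j) M (free j (ℕP.m≤n⇒m≤1+n j≤m)) (ι-<-≢0 j<1+m) (free (suc m) ℕP.≤-refl)) ⟩
    res m j * ((a * a) * s + T * a + T * inv (M - ι j)) ≡⟨ regroup₂ (res m j) a (inv (M - ι j)) s T ⟩
    sq j * s + T * (old j + r j)                 ∎
    where
    j≤m = ℕP.≤-pred j<1+m
    a = inv (y + ι j)
    regroup₁ : ∀ r u i A → r * u * i * A ≡ r * (u * i * A)
    regroup₁ = solve-∀ ℚ-ring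
    regroup₂ : ∀ r a b s T → r * ((a * a) * s + T * a + T * b) ≡ (r * (a * a)) * s + T * (r * a + r * b)
    regroup₂ = solve-∀ ℚ-ring

pfDeriv≡partialFractions*logDeriv : ∀ m y → PoleFree m y → ZeroFree m y → pfDeriv m y ≡ partialFractions m y * logDeriv m y
pfDeriv≡partialFractions*logDeriv zero y _ _ = base (inv (y + 0ℚ))
  where
  base : ∀ i → 0ℚ + 1ℚ * 1ℚ * (i * i) ≡ (0ℚ + 1ℚ * 1ℚ * i) * (0ℚ + (0ℚ + i))
  base = solve-∀ ℚ-ring
pfDeriv≡partialFractions*logDeriv (suc m) y free zfree = begin
  pfDeriv (suc m) y                                  ≡⟨ pfDeriv-suc m y free ⟩
  pfDeriv m y * s + T * (g + R) + W * (c * c)        ≡⟨ collect (pfDeriv m y) s (ι (suc m)) c g R W ⟩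
  pfDeriv m y * s + T * g + (c * c) * ((M + M) * R + W) ≡⟨ cong₂ (λ a b → a * s + T * g + (c * c) * b) IH (res-balanced m) ⟩
  g * L * s + T * g + (c * c) * 0ℚ                   ≡⟨ cong (λ z → g * L * s + z * g + (c * c) * 0ℚ) (split-[M+M]/[y+M]² y M (free (suc m) ℕP.≤-refl) (zfree m ℕP.≤-refl)) ⟩
  g * L * s + (s * (d + c)) * g + (c * c) * 0ℚ       ≡⟨ regroup g L₁ L₂ s d c ⟩
  g * s * ((L₁ + d) + (L₂ + c))                      ≡⟨ cong (_* logDeriv (suc m) y) (partialFractions-suc m y free (res-balanced m)) ⟨
  partialFractions (suc m) y * logDeriv (suc m) y    ∎
  where
  open ≡-Reasoning
  M = ι (suc m)
  c = inv (y + M)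
  d = inv (M - y)
  s = (M - y) * c
  T = (M + M) * c * c
  g = partialFractions m y
  R = regularPart m (suc m)
  W = res (suc m) (suc m)
  L = logDeriv m y
  L₁ = Σ m (λ i → inv (ι (suc i) - y))
  L₂ = Σ (suc m) (λ i → inv (y + ι i))
  IH : pfDeriv m y ≡ g * L
  IH = pfDeriv≡partialFractions*logDeriv m y (PoleFree-mono {x = y} (ℕP.n≤1+n m) free) (λ i i<m → zfree i (ℕP.m<n⇒m<1+n i<m))
  collect : ∀ D s M c g R W → D * s + (M + M) * c * c * (g + R) + W * (c * c) ≡ D * s + (M + M) * c * c * g + (c * c) * ((M + M) * R + W)
  collect = solve-∀ ℚ-ring
  regroup : ∀ g L₁ L₂ s d c → g * (L₁ + L₂) * s + (s * (d + c)) * g + (c * c) * 0ℚ ≡ g * s * ((L₁ + d) + (L₂ + c))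
  regroup = solve-∀ ℚ-ring

-- Regular parts at the poles

hPart : ℕ → ℕ → ℚ
hPart m k = H (m ℕ.+ k) + H (m ∸ k) - (H k + H k)

hPart-suc : ∀ {m k} → k ≤ m → hPart (suc m) k ≡ hPart m k + inv (ι (suc m) + ι k) + inv (ι (suc m) - ι k)
hPart-suc {m} {k} k≤m = begin
  H (suc (m ℕ.+ k)) + H (suc m ∸ k) - (H k + H k)
    ≡⟨ cong (λ z → H (suc (m ℕ.+ k)) + H z - (H k + H k)) 1+m∸k ⟩
  (H (m ℕ.+ k) + inv (ι (suc (m ℕ.+ k)))) + (H (m ∸ k) + inv (ι (suc (m ∸ k)))) - (H k + H k)
    ≡⟨ cong₂ (λ a b → (H (m ℕ.+ k) + inv a) + (H (m ∸ k) + inv b) - (H k + H k)) (ι-+ (suc m) k) ι[1+m∸k] ⟩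
  (H (m ℕ.+ k) + inv (ι (suc m) + ι k)) + (H (m ∸ k) + inv (ι (suc m) - ι k)) - (H k + H k)
    ≡⟨ regroup (H (m ℕ.+ k)) (H (m ∸ k)) (H k) _ _ ⟩
  hPart m k + inv (ι (suc m) + ι k) + inv (ι (suc m) - ι k) ∎
  where
  open ≡-Reasoning
  1+m∸k : suc m ∸ k ≡ suc (m ∸ k)
  1+m∸k = ℕP.+-∸-assoc 1 k≤m
  ι[1+m∸k] : ι (suc (m ∸ k)) ≡ ι (suc m) - ι k
  ι[1+m∸k] = trans (cong ι (sym 1+m∸k)) (ι-∸ (suc m) k (ℕP.m≤n⇒m≤1+n k≤m))
  regroup : ∀ a b h x y → (a + x) + (b + y) - (h + h) ≡ a + b - (h + h) + x + y
  regroup = solve-∀ ℚ-ring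

split-[M+M]/[M-k]² : ∀ M k → M - k ≢ 0ℚ → M + k ≢ 0ℚ →
  (M + M) * inv (M - k) * inv (M - k) ≡ (M + k) * inv (M - k) * inv (M + k) + (M + k) * inv (M - k) * inv (M - k)
split-[M+M]/[M-k]² M k M-k≢0 M+k≢0 =
  ≡-modulo-inverses _ _ ((M + M) * b * b + (- ((M + k) * b * b))) (- ((M + k) * b * c)) 0ℚ _ _ 1ℚ
    (certificate M k b c) (inv-inverseʳ _ M+k≢0) (inv-inverseʳ _ M-k≢0) refl
  where
  b = inv (M - k)
  c = inv (M + k)
  certificate : ∀ M k b c → (M + M) * b * b - ((M + k) * b * c + (M + k) * b * b)
    ≡ ((M + M) * b * b + (- ((M + k) * b * b))) * (1ℚ - (M + k) * c) + (- ((M + k) * b * c)) * (1ℚ - (M - k) * b)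
      + 0ℚ * (1ℚ - 1ℚ)
  certificate = solve-∀ ℚ-ring

split-[M+j]/[M-j]² : ∀ M j → M - j ≢ 0ℚ → (M + j) * inv (M - j) * inv (M - j) ≡ (M + M) * inv (M - j) * inv (M - j) - inv (M - j)
split-[M+j]/[M-j]² M j M-j≢0 =
  ≡-modulo-inverses _ _ b 0ℚ 0ℚ _ 1ℚ 1ℚ (certificate M j b) (inv-inverseʳ _ M-j≢0) refl refl
  where
  b = inv (M - j)
  certificate : ∀ M j b → (M + j) * b * b - ((M + M) * b * b - b) ≡ b * (1ℚ - (M - j) * b) + 0ℚ * (1ℚ - 1ℚ) + 0ℚ * (1ℚ - 1ℚ)
  certificate = solve-∀ ℚ-ring

res-suc/[k-j] : ∀ {m k j} → k ≤ m → j ≤ m → j ≢ k →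
  let M = ι (suc m); b = inv (M - ι k) in
  res (suc m) j * inv (ι k - ι j) ≡ res m j * inv (ι k - ι j) * ((M + ι k) * b) + - ((M + M) * b) * (res m j * inv (M - ι j))
res-suc/[k-j] {m} {k} {j} k≤m j≤m j≢k = begin
  res (suc m) j * inv (ι k - ι j)                      ≡⟨ cong₂ _*_ (res-suc j≤m) (inv-[a-b]≡-inv-[-a+b] (ι k) (ι j)) ⟩
  res m j * (M + ι j) * bj * - a                       ≡⟨ regroup₁ (res m j) (M + ι j) bj a ⟩
  - res m j * ((M + ι j) * bj * a)                     ≡⟨ cong (- res m j *_) (split-[M+j]/[M-j][x+j] (- ι k) (ι j) M (-ι+ι≢0 j≢k) (ι-<-≢0 (s≤s j≤m)) -k+M≢0) ⟩
  - res m j * (a * (M - - ι k) * c + (M + M) * bj * c) ≡⟨ cong (λ z → - res m j * (a * (M - - ι k) * inv z + (M + M) * bj * inv z)) (QP.+-comm (- ι k) M) ⟩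
  - res m j * (a * (M - - ι k) * b + (M + M) * bj * b) ≡⟨ regroup₂ (res m j) M (ι j) (ι k) a b bj ⟩
  res m j * - a * ((M + ι k) * b) + - ((M + M) * b) * (res m j * bj) ≡⟨ cong (λ z → res m j * z * ((M + ι k) * b) + - ((M + M) * b) * (res m j * bj)) (inv-[a-b]≡-inv-[-a+b] (ι k) (ι j)) ⟨
  res m j * inv (ι k - ι j) * ((M + ι k) * b) + - ((M + M) * b) * (res m j * bj) ∎
  where
  open ≡-Reasoning
  M = ι (suc m)
  a = inv (- ι k + ι j)
  b = inv (M - ι k)
  bj = inv (M - ι j)
  c = inv (- ι k + M)
  -k+M≢0 : - ι k + M ≢ 0ℚ
  -k+M≢0 = -ι+ι≢0 (λ 1+m≡k → ℕP.<-irrefl (sym 1+m≡k) (s≤s k≤m))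
  regroup₁ : ∀ r u b a → r * u * b * - a ≡ - r * (u * b * a)
  regroup₁ = solve-∀ ℚ-ring
  regroup₂ : ∀ r M j k a b bj → - r * (a * (M - - k) * b + (M + M) * bj * b) ≡ r * - a * ((M + k) * b) + - ((M + M) * b) * (r * bj)
  regroup₂ = solve-∀ ℚ-ring

regularPart-suc : ∀ {m k} → k ≤ m →
  let M = ι (suc m); b = inv (M - ι k) in
  regularPart (suc m) k ≡ regularPart m k * ((M + ι k) * b) + (M + M) * b * b * res m k
                          - b * ((M + M) * regularPart m (suc m) + res (suc m) (suc m))
regularPart-suc {m} {k} k≤m = begin
  Σ (suc m) new + W * inv (ι k - M)              ≡⟨ cong₂ _+_ (sum-≡-except (suc m) k new lin (s≤s k≤m) off) (cong (W *_) (inv-swap (ι k) M)) ⟩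
  (Σ (suc m) lin + (new k - lin k)) + W * - b    ≡⟨ cong (λ z → (z + (new k - lin k)) + W * - b) (sum-linear (suc m) old r s C) ⟩
  (R * s + C * Rtop + (new k - lin k)) + W * - b ≡⟨ cong (λ z → (R * s + C * Rtop + z) + W * - b) diagonal ⟩
  (R * s + C * Rtop + (M + M) * b * b * res m k) + W * - b ≡⟨ regroup R s M b Rtop (res m k) W ⟩
  R * s + (M + M) * b * b * res m k - b * ((M + M) * Rtop + W) ∎
  where
  open ≡-Reasoning
  M = ι (suc m)
  b = inv (M - ι k)
  s = (M + ι k) * b
  C = - ((M + M) * b)
  R = regularPart m k
  Rtop = regularPart m (suc m)
  W = res (suc m) (suc m)
  new old r lin : ℕ → ℚ
  new j = res (suc m) j * inv (ι k - ι j)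
  old j = res m j * inv (ι k - ι j)
  r j = res m j * inv (M - ι j)
  lin j = old j * s + C * r j
  off : ∀ j → j < suc m → j ≢ k → new j ≡ lin j
  off j j<1+m = res-suc/[k-j] k≤m (ℕP.≤-pred j<1+m)
  diagonal : new k - lin k ≡ (M + M) * b * b * res m k
  diagonal = begin
    res (suc m) k * inv (ι k - ι k) - (res m k * inv (ι k - ι k) * s + C * (res m k * b))
      ≡⟨ cong (λ z → res (suc m) k * z - (res m k * z * s + C * (res m k * b))) (inv-ι-self k) ⟩
    res (suc m) k * 0ℚ - (res m k * 0ℚ * s + C * (res m k * b))
      ≡⟨ simplify (res (suc m) k) (res m k) s M b ⟩
    (M + M) * b * b * res m k ∎
    where
    simplify : ∀ W w s M b → W * 0ℚ - (w * 0ℚ * s + - ((M + M) * b) * (w * b)) ≡ (M + M) * b * b * w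
    simplify = solve-∀ ℚ-ring
  regroup : ∀ R s M b Rtop w W → (R * s + - ((M + M) * b) * Rtop + (M + M) * b * b * w) + W * - b
            ≡ R * s + (M + M) * b * b * w - b * ((M + M) * Rtop + W)
  regroup = solve-∀ ℚ-ring

regularPart-step : ∀ {m k} → k ≤ m → regularPart m k ≡ res m k * hPart m k →
  regularPart (suc m) k ≡ res (suc m) k * hPart (suc m) k
regularPart-step {m} {k} k≤m IH = begin
  regularPart (suc m) k                                        ≡⟨ regularPart-suc k≤m ⟩
  regularPart m k * s + (M + M) * b * b * w - b * balance     ≡⟨ cong₂ (λ a z → a * s + (M + M) * b * b * w - b * z) IH (res-balanced m) ⟩
  w * h * s + (M + M) * b * b * w - b * 0ℚ                    ≡⟨ cong (λ z → w * h * s + z * w - b * 0ℚ) (split-[M+M]/[M-k]² M (ι k) (ι-<-≢0 (s≤s k≤m)) M+k≢0) ⟩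
  w * h * s + ((M + ι k) * b * c + (M + ι k) * b * b) * w - b * 0ℚ ≡⟨ regroup w h M (ι k) b c ⟩
  w * (M + ι k) * b * (h + c + b)                             ≡⟨ cong₂ _*_ (res-suc k≤m) (hPart-suc k≤m) ⟨
  res (suc m) k * hPart (suc m) k                             ∎
  where
  open ≡-Reasoning
  M = ι (suc m)
  b = inv (M - ι k)
  c = inv (M + ι k)
  s = (M + ι k) * b
  w = res m k
  h = hPart m k
  balance = (M + M) * regularPart m (suc m) + res (suc m) (suc m)
  M+k≢0 : M + ι k ≢ 0ℚ
  M+k≢0 M+k≡0 = ι-suc≢0 (m ℕ.+ k) (trans (ι-+ (suc m) k) M+k≡0)
  regroup : ∀ w h M k b c → w * h * ((M + k) * b) + ((M + k) * b * c + (M + k) * b * b) * w - b * 0ℚ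
            ≡ w * (M + k) * b * (h + c + b)
  regroup = solve-∀ ℚ-ring

logDeriv-at-negative : ∀ m → logDeriv m (- ι (suc m)) ≡ (H (suc m ℕ.+ m) - H (suc m)) + - H (suc m)
logDeriv-at-negative m = cong₂ _+_ zeros poles
  where
  open ≡-Reasoning
  M = suc m
  zeros : Σ m (λ i → inv (ι (suc i) - - ι M)) ≡ H (M ℕ.+ m) - H M
  zeros = begin
    Σ m (λ i → inv (ι (suc i) - - ι M))                ≡⟨ sum-cong m (λ i _ → cong inv (shift i)) ⟩
    Σ m (λ i → inv (ι (suc (M ℕ.+ i))))                ≡⟨ cancel (H M) _ ⟩
    (H M + Σ m (λ i → inv (ι (suc (M ℕ.+ i))))) - H M  ≡⟨ cong (_- H M) (sum-split M m (λ i → inv (ι (suc i)))) ⟨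
    H (M ℕ.+ m) - H M                                  ∎
    where
    minus-neg : ∀ a b → a - - b ≡ a + b
    minus-neg = solve-∀ ℚ-ring
    shift : ∀ i → ι (suc i) - - ι M ≡ ι (suc (M ℕ.+ i))
    shift i = trans (minus-neg (ι (suc i)) (ι M)) (trans (sym (ι-+ (suc i) M)) (cong (λ z → ι (suc z)) (ℕP.+-comm i M)))
    cancel : ∀ h a → a ≡ (h + a) - h
    cancel = solve-∀ ℚ-ring
  poles : Σ M (λ i → inv (- ι M + ι i)) ≡ - H M
  poles = begin
    Σ M (λ i → inv (- ι M + ι i))          ≡⟨ sum-cong M (λ i _ → inv-[-a+b]≡-inv-[a-b] (ι M) (ι i)) ⟩
    Σ M (λ i → - inv (ι M - ι i))          ≡⟨ sum-neg M (λ i → inv (ι M - ι i)) ⟩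
    - Σ M (λ i → inv (ι M - ι i))          ≡⟨ cong -_ (sum-reverse M (λ i → inv (ι M - ι i))) ⟩
    - Σ M (λ i → inv (ι M - ι (m ∸ i)))    ≡⟨ cong -_ (sum-cong M (λ i i<M → cong inv (reflect (ℕP.≤-pred i<M)))) ⟩
    - H M                                  ∎
    where
    reflect : ∀ {i} → i ≤ m → ι M - ι (m ∸ i) ≡ ι (suc i)
    reflect {i} i≤m = begin
      ι M - ι (m ∸ i)            ≡⟨ cong₂ _-_ (ι-suc m) (ι-∸ m i i≤m) ⟩
      (1ℚ + ι m) - (ι m - ι i)   ≡⟨ simplify (ι m) (ι i) ⟩
      1ℚ + ι i                   ≡⟨ ι-suc i ⟨
      ι (suc i)                  ∎
      where
      simplify : ∀ a b → (1ℚ + a) - (a - b) ≡ 1ℚ + b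
      simplify = solve-∀ ℚ-ring

sum-res-suc/[M-j] : ∀ m → let M = ι (suc m) in
  Σ (suc m) (λ j → res (suc m) j * inv (M - ι j)) ≡ pfDeriv m (- M) * (M + M) + - 1ℚ * regularPart m (suc m)
sum-res-suc/[M-j] m = trans (sum-cong (suc m) term) (sum-linear (suc m) (λ j → res m j * (a j * a j)) (λ j → res m j * b j) (M + M) (- 1ℚ))
  where
  open ≡-Reasoning
  M = ι (suc m)
  a b : ℕ → ℚ
  a j = inv (- M + ι j)
  b j = inv (M - ι j)
  term : ∀ j → j < suc m → res (suc m) j * b j ≡ res m j * (a j * a j) * (M + M) + - 1ℚ * (res m j * b j)
  term j j<1+m = begin
    res (suc m) j * b j                    ≡⟨ cong (_* b j) (res-suc (ℕP.≤-pred j<1+m)) ⟩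
    res m j * (M + ι j) * b j * b j        ≡⟨ regroup₁ (res m j) (M + ι j) (b j) ⟩
    res m j * ((M + ι j) * b j * b j)      ≡⟨ cong (res m j *_) (split-[M+j]/[M-j]² M (ι j) (ι-<-≢0 j<1+m)) ⟩
    res m j * ((M + M) * b j * b j - b j)  ≡⟨ regroup₂ (res m j) M (b j) ⟩
    res m j * (- b j * - b j) * (M + M) + - 1ℚ * (res m j * b j) ≡⟨ cong (λ z → res m j * (z * z) * (M + M) + - 1ℚ * (res m j * b j)) (inv-[-a+b]≡-inv-[a-b] M (ι j)) ⟨
    res m j * (a j * a j) * (M + M) + - 1ℚ * (res m j * b j) ∎
    where
    regroup₁ : ∀ r u b → r * u * b * b ≡ r * (u * b * b)
    regroup₁ = solve-∀ ℚ-ring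
    regroup₂ : ∀ r M b → r * ((M + M) * b * b - b) ≡ r * (- b * - b) * (M + M) + - 1ℚ * (r * b)
    regroup₂ = solve-∀ ℚ-ring

partialFractions-at-next : ∀ m → partialFractions m (- ι (suc m)) ≡ - regularPart m (suc m)
partialFractions-at-next m = begin
  partialFractions m y      ≡⟨ pochRatio≡partialFractions m y (PoleFree-negative ℕP.≤-refl) ⟨
  pochRatio m y             ≡⟨ neg-neg (pochRatio m y) ⟨
  - - pochRatio m y         ≡⟨ cong -_ (regularPart-beyond (pochRatio≡partialFractions m) ℕP.≤-refl) ⟨
  - regularPart m (suc m)   ∎
  where
  open ≡-Reasoning
  y = - ι (suc m)
  neg-neg : ∀ p → - - p ≡ p
  neg-neg = solve-∀ ℚ-ring

res-diagonal≡-regularPart : ∀ m → res (suc m) (suc m) ≡ - ((ι (suc m) + ι (suc m)) * regularPart m (suc m))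
res-diagonal≡-regularPart m = p-q≡0⇒p≡q _ _ (trans (swap (res (suc m) (suc m)) _) (res-balanced m))
  where
  swap : ∀ W a → W - - a ≡ a + W
  swap = solve-∀ ℚ-ring

hPart-diagonal : ∀ m → hPart (suc m) (suc m) ≡ (H (suc m ℕ.+ m) + inv (ι (suc m) + ι (suc m))) + 0ℚ - (H (suc m) + H (suc m))
hPart-diagonal m = begin
  H (suc (m ℕ.+ suc m)) + H (suc m ∸ suc m) - (H₀ + H₀)
    ≡⟨ cong (λ z → H (suc (m ℕ.+ suc m)) + H z - (H₀ + H₀)) (ℕP.n∸n≡0 (suc m)) ⟩
  (H (m ℕ.+ suc m) + inv (ι (suc m ℕ.+ suc m))) + 0ℚ - (H₀ + H₀)
    ≡⟨ cong₂ (λ a b → (H a + inv b) + 0ℚ - (H₀ + H₀)) (ℕP.+-comm m (suc m)) (ι-+ (suc m) (suc m)) ⟩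
  (H (suc m ℕ.+ m) + inv (ι (suc m) + ι (suc m))) + 0ℚ - (H₀ + H₀) ∎
  where
  open ≡-Reasoning
  H₀ = H (suc m)

regularPart-diagonal : ∀ m → regularPart (suc m) (suc m) ≡ res (suc m) (suc m) * hPart (suc m) (suc m)
regularPart-diagonal m = begin
  Σ (suc m) (λ j → res (suc m) j * inv (M - ι j)) + W * inv (M - M) ≡⟨ cong₂ _+_ (sum-res-suc/[M-j] m) (cong (W *_) (inv-ι-self (suc m))) ⟩
  (pfDeriv m y * T + - 1ℚ * R) + W * 0ℚ                         ≡⟨ cong (λ z → (z * T + - 1ℚ * R) + W * 0ℚ) derivative ⟩
  (partialFractions m y * logDeriv m y * T + - 1ℚ * R) + W * 0ℚ ≡⟨ cong₂ (λ a b → (a * b * T + - 1ℚ * R) + W * 0ℚ) (partialFractions-at-next m) (logDeriv-at-negative m) ⟩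
  (- R * (H₁ - H₀ + - H₀) * T + - 1ℚ * R) + W * 0ℚ              ≡⟨ cong (λ z → (- R * (H₁ - H₀ + - H₀) * T + - 1ℚ * R) + z * 0ℚ) (res-diagonal≡-regularPart m) ⟩
  (- R * (H₁ - H₀ + - H₀) * T + - 1ℚ * R) + - (T * R) * 0ℚ      ≡⟨ ≡-modulo-inverses _ _ (- R) 0ℚ 0ℚ _ 1ℚ 1ℚ (certificate R H₁ H₀ T (inv T)) (inv-inverseʳ T T≢0) refl refl ⟩
  - (T * R) * ((H₁ + inv T) + 0ℚ - (H₀ + H₀))                   ≡⟨ cong₂ _*_ (res-diagonal≡-regularPart m) (hPart-diagonal m) ⟨
  W * hPart (suc m) (suc m)                                     ∎
  where
  open ≡-Reasoning
  M = ι (suc m)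
  y = - M
  T = M + M
  R = regularPart m (suc m)
  W = res (suc m) (suc m)
  H₀ = H (suc m)
  H₁ = H (suc m ℕ.+ m)
  T≢0 : T ≢ 0ℚ
  T≢0 T≡0 = ι-suc≢0 (m ℕ.+ suc m) (trans (ι-+ (suc m) (suc m)) T≡0)
  derivative : pfDeriv m y ≡ partialFractions m y * logDeriv m y
  derivative = pfDeriv≡partialFractions*logDeriv m y (PoleFree-negative ℕP.≤-refl) (ZeroFree-negative m (suc m))
  certificate : ∀ R H₁ H₀ T i → (- R * (H₁ - H₀ + - H₀) * T + - 1ℚ * R) + - (T * R) * 0ℚ - - (T * R) * ((H₁ + i) + 0ℚ - (H₀ + H₀))
                ≡ - R * (1ℚ - T * i) + 0ℚ * (1ℚ - 1ℚ) + 0ℚ * (1ℚ - 1ℚ)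
  certificate = solve-∀ ℚ-ring

regularPart≡res*hPart : ∀ {m k} → k ≤ m → regularPart m k ≡ res m k * hPart m k
regularPart≡res*hPart {zero} {zero} z≤n = refl
regularPart≡res*hPart {suc m} {k} k≤1+m with ℕP.m≤n⇒m<n∨m≡n k≤1+m
... | inj₁ k<1+m = regularPart-step (ℕP.≤-pred k<1+m) (regularPart≡res*hPart (ℕP.≤-pred k<1+m))
... | inj₂ refl = regularPart-diagonal m

-- The product of the two expansions

split-x/[x+k][x+j] : ∀ x k j → x + k ≢ 0ℚ → x + j ≢ 0ℚ → k - j ≢ 0ℚ →
  x * inv (x + k) * inv (x + j) ≡ k * inv (k - j) * inv (x + k) + j * - inv (k - j) * inv (x + j)
split-x/[x+k][x+j] x k j x+k≢0 x+j≢0 k-j≢0 =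
  ≡-modulo-inverses _ _ (x * a * b) (- (k * d * a)) (j * d * b) _ _ _
    (certificate x k j a b d) (inv-inverseʳ _ k-j≢0) (inv-inverseʳ _ x+j≢0) (inv-inverseʳ _ x+k≢0)
  where
  a = inv (x + k)
  b = inv (x + j)
  d = inv (k - j)
  certificate : ∀ x k j a b d → x * a * b - (k * d * a + j * - d * b)
    ≡ (x * a * b) * (1ℚ - (k - j) * d) + (- (k * d * a)) * (1ℚ - (x + j) * b) + (j * d * b) * (1ℚ - (x + k) * a)
  certificate = solve-∀ ℚ-ring

split-x/[x+k]² : ∀ x k → x + k ≢ 0ℚ → x * inv (x + k) * inv (x + k) ≡ inv (x + k) - k * inv (x + k) * inv (x + k)
split-x/[x+k]² x k x+k≢0 =
  ≡-modulo-inverses _ _ (- a) 0ℚ 0ℚ _ 1ℚ 1ℚ (certificate x k a) (inv-inverseʳ _ x+k≢0) refl refl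
  where
  a = inv (x + k)
  certificate : ∀ x k a → x * a * a - (a - k * a * a) ≡ (- a) * (1ℚ - (x + k) * a) + 0ℚ * (1ℚ - 1ℚ) + 0ℚ * (1ℚ - 1ℚ)
  certificate = solve-∀ ℚ-ring

res*res≡aCoef : ∀ m n k → res n k * res m k ≡ aCoef m n k
res*res≡aCoef m n k = begin
  (sgn k * ι (c ℕ.* d)) * (sgn k * ι (A ℕ.* B))  ≡⟨ regroup (sgn k) (ι (c ℕ.* d)) (ι (A ℕ.* B)) ⟩
  (sgn k * sgn k) * (ι (A ℕ.* B) * ι (c ℕ.* d))  ≡⟨ cong₂ (λ s z → s * (ι (A ℕ.* B) * z)) (sgn*sgn≡1 k) (ι-* c d) ⟩
  1ℚ * (ι (A ℕ.* B) * (ι c * ι d))               ≡⟨ regroup′ (ι (A ℕ.* B)) (ι c) (ι d) ⟩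
  ι (A ℕ.* B) * ι c * ι d                        ≡⟨ cong (_* ι d) (ι-* (A ℕ.* B) c) ⟨
  ι (A ℕ.* B ℕ.* c) * ι d                        ≡⟨ ι-* (A ℕ.* B ℕ.* c) d ⟨
  aCoef m n k                                    ∎
  where
  open ≡-Reasoning
  A = (m ℕ.+ k) C k
  B = m C k
  c = (n ℕ.+ k) C k
  d = n C k
  regroup : ∀ s a b → (s * a) * (s * b) ≡ (s * s) * (b * a)
  regroup = solve-∀ ℚ-ring
  regroup′ : ∀ a b c → 1ℚ * (a * (b * c)) ≡ a * b * c
  regroup′ = solve-∀ ℚ-ring

hCoef≡hPart+hPart : ∀ m n k → hCoef m n k ≡ hPart m k + hPart n k
hCoef≡hPart+hPart m n k = regroup (H (m ℕ.+ k)) (H (m ∸ k)) (H (n ℕ.+ k)) (H (n ∸ k)) (H k)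
  where
  regroup : ∀ a b c d h → a + b + c + d - (1ℚ + 1ℚ + 1ℚ + 1ℚ) * h ≡ (a + b - (h + h)) + (c + d - (h + h))
  regroup = solve-∀ ℚ-ring

lhs≡x*partialFractions*partialFractions : ∀ m n x → n ≤ m → PoleFree m x → lhs m n x ≡ x * partialFractions n x * partialFractions m x
lhs≡x*partialFractions*partialFractions m n x n≤m free = begin
  (x * a * b) * inv (c * d)          ≡⟨ cong ((x * a * b) *_) (inv-* c d) ⟩
  (x * a * b) * (inv c * inv d)      ≡⟨ regroup x a b (inv c) (inv d) ⟩
  x * pochRatio n x * pochRatio m x  ≡⟨ cong₂ (λ p q → x * p * q) (pochRatio≡partialFractions n x (PoleFree-mono {x = x} n≤m free))
                                                                (pochRatio≡partialFractions m x free) ⟩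
  x * partialFractions n x * partialFractions m x ∎
  where
  open ≡-Reasoning
  a = poch (1ℚ - x) n
  b = poch (1ℚ - x) m
  c = poch x (suc n)
  d = poch x (suc m)
  regroup : ∀ x a b c d → (x * a * b) * (c * d) ≡ x * (a * c) * (b * d)
  regroup = solve-∀ ℚ-ring

module Expansion (m n : ℕ) (n≤m : n ≤ m) (x : ℚ) (free : PoleFree m x) where
  open ≡-Reasoning

  X : ℕ → ℚ
  X k = inv (x + ι k)

  free-n : PoleFree n x
  free-n = PoleFree-mono {x = x} n≤m free

  polesOfFirst polesOfSecond onDiagonal : ℕ → ℚ
  polesOfFirst k = (res n k * ι k * X k) * regularPart m k
  polesOfSecond j = (res m j * ι j * X j) * regularPart n j
  onDiagonal k = res n k * res m k * (X k - ι k * X k * X k)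

  term : ℕ → ℕ → ℚ
  term k j = res n k * res m j * (x * X k * X j)

  cross : ℕ → ℕ → ℚ
  cross k j = (res n k * ι k * X k) * (res m j * inv (ι k - ι j)) + (res m j * ι j * X j) * (res n k * inv (ι j - ι k))

  term≡cross : ∀ k j → k ≤ n → j ≤ m → j ≢ k → term k j ≡ cross k j
  term≡cross k j k≤n j≤m j≢k = begin
    res n k * res m j * (x * X k * X j)
      ≡⟨ cong (res n k * res m j *_) (split-x/[x+k][x+j] x (ι k) (ι j) (free-n k k≤n) (free j j≤m) (ι-≢ (λ k≡j → j≢k (sym k≡j)))) ⟩
    res n k * res m j * (ι k * d * X k + ι j * - d * X j)
      ≡⟨ regroup (res n k) (res m j) (ι k) (ι j) d (X k) (X j) ⟩
    (res n k * ι k * X k) * (res m j * d) + (res m j * ι j * X j) * (res n k * - d)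
      ≡⟨ cong (λ z → (res n k * ι k * X k) * (res m j * d) + (res m j * ι j * X j) * (res n k * z)) (inv-swap (ι j) (ι k)) ⟨
    cross k j ∎
    where
    d = inv (ι k - ι j)
    regroup : ∀ a b K J d u v → a * b * (K * d * u + J * - d * v) ≡ (a * K * u) * (b * d) + (b * J * v) * (a * - d)
    regroup = solve-∀ ℚ-ring

  term-cross-diagonal : ∀ k → k ≤ n → term k k - cross k k ≡ onDiagonal k
  term-cross-diagonal k k≤n = begin
    term k k - ((res n k * ι k * X k) * (res m k * inv (ι k - ι k)) + (res m k * ι k * X k) * (res n k * inv (ι k - ι k)))
      ≡⟨ cong (λ z → term k k - ((res n k * ι k * X k) * (res m k * z) + (res m k * ι k * X k) * (res n k * z))) (inv-ι-self k) ⟩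
    term k k - ((res n k * ι k * X k) * (res m k * 0ℚ) + (res m k * ι k * X k) * (res n k * 0ℚ))
      ≡⟨ simplify (res n k) (res m k) (x * X k * X k) (ι k) (X k) ⟩
    res n k * res m k * (x * X k * X k)
      ≡⟨ cong (res n k * res m k *_) (split-x/[x+k]² x (ι k) (free-n k k≤n)) ⟩
    onDiagonal k ∎
    where
    simplify : ∀ a b z K i → a * b * z - ((a * K * i) * (b * 0ℚ) + (b * K * i) * (a * 0ℚ)) ≡ a * b * z
    simplify = solve-∀ ℚ-ring

  row : ∀ k → k ≤ n → Σ (suc m) (term k) ≡ polesOfFirst k + onDiagonal k + Σ (suc m) (λ j → (res m j * ι j * X j) * (res n k * inv (ι j - ι k)))
  row k k≤n = begin
    Σ (suc m) (term k)                         ≡⟨ sum-≡-except (suc m) k (term k) (cross k) (s≤s k≤m) (λ j j<1+m → term≡cross k j k≤n (ℕP.≤-pred j<1+m)) ⟩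
    Σ (suc m) (cross k) + (term k k - cross k k) ≡⟨ cong₂ _+_ (sum-+ (suc m) first second) (term-cross-diagonal k k≤n) ⟩
    (Σ (suc m) first + Σ (suc m) second) + onDiagonal k ≡⟨ cong (λ z → (z + Σ (suc m) second) + onDiagonal k) (sum-*ˡ (suc m) (res n k * ι k * X k) (λ j → res m j * inv (ι k - ι j))) ⟩
    (polesOfFirst k + Σ (suc m) second) + onDiagonal k ≡⟨ swap (polesOfFirst k) (Σ (suc m) second) (onDiagonal k) ⟩
    polesOfFirst k + onDiagonal k + Σ (suc m) second ∎
    where
    k≤m = ℕP.≤-trans k≤n n≤m
    first second : ℕ → ℚ
    first j = (res n k * ι k * X k) * (res m j * inv (ι k - ι j))
    second j = (res m j * ι j * X j) * (res n k * inv (ι j - ι k))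
    swap : ∀ a b c → (a + b) + c ≡ a + c + b
    swap = solve-∀ ℚ-ring

  product-expansion : x * partialFractions n x * partialFractions m x
    ≡ Σ (suc n) (λ k → polesOfFirst k + onDiagonal k) + Σ (suc m) polesOfSecond
  product-expansion = begin
    x * partialFractions n x * partialFractions m x
      ≡⟨ cong (_* partialFractions m x) (sum-*ˡ (suc n) x (λ k → res n k * X k)) ⟨
    Σ (suc n) (λ k → x * (res n k * X k)) * partialFractions m x
      ≡⟨ sum-*-sum (suc n) (suc m) (λ k → x * (res n k * X k)) (λ j → res m j * X j) ⟩
    Σ (suc n) (λ k → Σ (suc m) (λ j → x * (res n k * X k) * (res m j * X j)))
      ≡⟨ sum-cong (suc n) (λ k _ → sum-cong (suc m) (λ j _ → regroup x (res n k) (X k) (res m j) (X j))) ⟩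
    Σ (suc n) (λ k → Σ (suc m) (term k))
      ≡⟨ sum-cong (suc n) (λ k k<1+n → row k (ℕP.≤-pred k<1+n)) ⟩
    Σ (suc n) (λ k → polesOfFirst k + onDiagonal k + Σ (suc m) (second k))
      ≡⟨ sum-+ (suc n) (λ k → polesOfFirst k + onDiagonal k) (λ k → Σ (suc m) (second k)) ⟩
    Σ (suc n) (λ k → polesOfFirst k + onDiagonal k) + Σ (suc n) (λ k → Σ (suc m) (second k))
      ≡⟨ cong (Σ (suc n) (λ k → polesOfFirst k + onDiagonal k) +_) (sum-swap (suc n) (suc m) second) ⟩
    Σ (suc n) (λ k → polesOfFirst k + onDiagonal k) + Σ (suc m) (λ j → Σ (suc n) (λ k → second k j))
      ≡⟨ cong (Σ (suc n) (λ k → polesOfFirst k + onDiagonal k) +_) (sum-cong (suc m) (λ j _ → sum-*ˡ (suc n) (res m j * ι j * X j) (λ k → res n k * inv (ι j - ι k)))) ⟩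
    Σ (suc n) (λ k → polesOfFirst k + onDiagonal k) + Σ (suc m) polesOfSecond ∎
    where
    second : ℕ → ℕ → ℚ
    second k j = (res m j * ι j * X j) * (res n k * inv (ι j - ι k))
    regroup : ∀ x a b c d → x * (a * b) * (c * d) ≡ a * c * (x * b * d)
    regroup = solve-∀ ℚ-ring

  nearPole : ℕ → ℚ
  nearPole k = aCoef m n k * ((- ι k) ÷' ((x + ι k) * (x + ι k)) + (1ℚ + ι k * hCoef m n k) ÷' (x + ι k))

  farPole : ℕ → ℚ
  farPole k = (sgn (k ∸ n) * bCoef m n k) ÷' (x + ι k)

  poles≡nearPole : ∀ k → k ≤ n → polesOfFirst k + onDiagonal k + polesOfSecond k ≡ nearPole k
  poles≡nearPole k k≤n = begin
    polesOfFirst k + onDiagonal k + polesOfSecond k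
      ≡⟨ cong₂ (λ a b → (res n k * ι k * X k) * a + onDiagonal k + (res m k * ι k * X k) * b)
               (regularPart≡res*hPart (ℕP.≤-trans k≤n n≤m)) (regularPart≡res*hPart k≤n) ⟩
    (res n k * ι k * X k) * (res m k * hPart m k) + onDiagonal k + (res m k * ι k * X k) * (res n k * hPart n k)
      ≡⟨ regroup (res n k) (res m k) (ι k) (X k) (hPart m k) (hPart n k) ⟩
    (res n k * res m k) * ((- ι k) * (X k * X k) + (1ℚ + ι k * (hPart m k + hPart n k)) * X k)
      ≡⟨ cong₂ (λ a b → a * ((- ι k) * b + (1ℚ + ι k * (hPart m k + hPart n k)) * X k)) (res*res≡aCoef m n k) (sym (inv-* (x + ι k) (x + ι k))) ⟩
    aCoef m n k * ((- ι k) * inv ((x + ι k) * (x + ι k)) + (1ℚ + ι k * (hPart m k + hPart n k)) * X k)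
      ≡⟨ cong (λ h → aCoef m n k * ((- ι k) * inv ((x + ι k) * (x + ι k)) + (1ℚ + ι k * h) * X k)) (hCoef≡hPart+hPart m n k) ⟨
    nearPole k ∎
    where
    regroup : ∀ a b K i hm hn → (a * K * i) * (b * hm) + a * b * (i - K * i * i) + (b * K * i) * (a * hn)
      ≡ (a * b) * ((- K) * (i * i) + (1ℚ + K * (hm + hn)) * i)
    regroup = solve-∀ ℚ-ring

  nearPole-0 : nearPole 0 ≡ inv x
  nearPole-0 = trans (simplify (inv ((x + 0ℚ) * (x + 0ℚ))) (hCoef m n 0) (inv (x + 0ℚ))) (cong inv (QP.+-identityʳ x))
    where
    simplify : ∀ a h i → 1ℚ * ((- 0ℚ) * a + (1ℚ + 0ℚ * h) * i) ≡ i
    simplify = solve-∀ ℚ-ring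

  polesOfSecond≡farPole : ∀ t → n ≤ t → polesOfSecond (suc t) ≡ farPole (suc t)
  polesOfSecond≡farPole t n≤t = begin
    (res m j * J * X j) * regularPart n j             ≡⟨ cong ((res m j * J * X j) *_) (regularPart-beyond (pochRatio≡partialFractions n) (s≤s n≤t)) ⟩
    (res m j * J * X j) * - p                         ≡⟨ regroup₁ (sgn j) (coeff m j) J (X j) p ⟩
    - sgn j * coeff m j * X j * (J * p)               ≡⟨ cong (- sgn j * coeff m j * X j *_) J*p ⟩
    - sgn j * coeff m j * X j * (sgn (suc n) * K * inv Ct) ≡⟨ regroup₂ (sgn j) (sgn n) (coeff m j) (X j) K (inv Ct) ⟩
    (sgn j * sgn n) * (coeff m j * K * inv Ct) * X j  ≡⟨ cong₂ (λ s z → s * (z * inv Ct) * X j) (sgn-∸ (ℕP.m≤n⇒m≤1+n n≤t)) (ι-* (((m ℕ.+ j) C j) ℕ.* (m C j)) ((n ℕ.+ j) C j)) ⟨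
    farPole j                                         ∎
    where
    j = suc t
    J = ι j
    p = pochRatio n (- J)
    K = ι ((n ℕ.+ j) C j)
    Ct = ι (t C n)
    Ct≢0 : Ct ≢ 0ℚ
    Ct≢0 Ct≡0 = k≤n⇒nCk≢0 n≤t (ι-injective {t C n} {0} Ct≡0)
    J*p : J * p ≡ sgn (suc n) * K * inv Ct
    J*p = begin
      J * p                     ≡⟨ inv-cancelˡ Ct (J * p) Ct≢0 ⟨
      inv Ct * (Ct * (J * p))   ≡⟨ cong (inv Ct *_) (reorder Ct J p) ⟩
      inv Ct * (J * Ct * p)     ≡⟨ cong (inv Ct *_) (pochRatio-at-negative n t n≤t) ⟩
      inv Ct * (sgn (suc n) * K) ≡⟨ QP.*-comm (inv Ct) _ ⟩
      sgn (suc n) * K * inv Ct  ∎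
      where
      reorder : ∀ c J p → c * (J * p) ≡ J * c * p
      reorder = solve-∀ ℚ-ring
    regroup₁ : ∀ s c J i p → (s * c * J * i) * - p ≡ - s * c * i * (J * p)
    regroup₁ = solve-∀ ℚ-ring
    regroup₂ : ∀ s σ c i K d → - s * c * i * (- σ * K * d) ≡ (s * σ) * (c * K * d) * i
    regroup₂ = solve-∀ ℚ-ring

  polesOfSecond-split : Σ (suc m) polesOfSecond ≡ Σ (suc n) polesOfSecond + sumFromTo (suc n) m farPole
  polesOfSecond-split = begin
    Σ (suc m) polesOfSecond                    ≡⟨ cong (λ N → Σ N polesOfSecond) (cong suc (ℕP.m+[n∸m]≡n n≤m)) ⟨
    Σ (suc n ℕ.+ (m ∸ n)) polesOfSecond        ≡⟨ sum-split (suc n) (m ∸ n) polesOfSecond ⟩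
    Σ (suc n) polesOfSecond + Σ (m ∸ n) (λ i → polesOfSecond (suc n ℕ.+ i)) ≡⟨ cong (Σ (suc n) polesOfSecond +_) (sum-cong (m ∸ n) (λ i _ → polesOfSecond≡farPole (n ℕ.+ i) (ℕP.m≤m+n n i))) ⟩
    Σ (suc n) polesOfSecond + sumFromTo (suc n) m farPole ∎

theorem3p1 : (m n : ℕ) → .{{_ : NonZero m}} → .{{_ : NonZero n}} → m ≥ n →
    (x : ℚ) → (∀ j → j ≤ m → x + ι j ≢ 0ℚ) →
    lhs m n x ≡ rhs m n x
theorem3p1 m n n≤m x free = begin
  lhs m n x                                         ≡⟨ lhs≡x*partialFractions*partialFractions m n x n≤m free ⟩
  x * partialFractions n x * partialFractions m x   ≡⟨ product-expansion ⟩
  Σ (suc n) first + Σ (suc m) polesOfSecond         ≡⟨ cong (Σ (suc n) first +_) polesOfSecond-split ⟩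
  Σ (suc n) first + (Σ (suc n) polesOfSecond + far) ≡⟨ QP.+-assoc (Σ (suc n) first) _ far ⟨
  Σ (suc n) first + Σ (suc n) polesOfSecond + far   ≡⟨ cong (_+ far) (sum-+ (suc n) first polesOfSecond) ⟨
  Σ (suc n) (λ k → first k + polesOfSecond k) + far ≡⟨ cong (_+ far) (sum-cong (suc n) (λ k k<1+n → poles≡nearPole k (ℕP.≤-pred k<1+n))) ⟩
  Σ (suc n) nearPole + far                          ≡⟨ cong (_+ far) (sum-unfoldˡ n nearPole) ⟩
  nearPole 0 + sumFromTo 1 n nearPole + far         ≡⟨ cong (λ z → z + sumFromTo 1 n nearPole + far) nearPole-0 ⟩
  rhs m n x                                         ∎
  where
  open ≡-Reasoning
  open Expansion m n n≤m x free
  first : ℕ → ℚ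
  first k = polesOfFirst k + onDiagonal k
  far : ℚ
  far = sumFromTo (suc n) m farPole
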